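{- \[\sum_{n\geq1}|\hat{\mathcal{B}}_n(123)|\,t^n=\frac{t^2-1+\sqrt{t^4+2t^2-4t+1}}{2(t-1)}.\]
   Context: An endofunction of size $n$ is a word $x=x_1\cdots x_n$ with entries in $\{1,\dots,n\}$; it is a Cayley permutation if it contains every integer between $1$ and $\max(x)$. Let $\mathrm{Ascbot}(x)=\{1\}\cup\{i:1\leq i\leq n-1,\ x_i<x_{i+1}\}$ and $\mathrm{Nub}(x)$ the set of indices $i$ such that $x_i$ is the leftmost occurrence of its value. A revised ascent sequence of length $n$ is a Cayley permutation $x$ of length $n$ with $\mathrm{Ascbot}(x)=\mathrm{Nub}(x)$. For Cayley permutations $x$ and $\sigma=\sigma_1\cdots\sigma_k$, $x$ contains $\sigma$ if there are indices $i_1<\cdots<i_k$ such that for all $s,t$: $x_{i_s}<x_{i_t}\iff\sigma_s<\sigma_t$ and $x_{i_s}=x_{i_t}\iff\sigma_s=\sigma_t$; otherwise $x$ avoids $\sigma$. $\hat{\mathcal{B}}_n(\sigma)$ is the set of revised ascent sequences of length $n$ avoiding $\sigma$. -}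

module Defs where

open import Data.Bool using (Bool; true; false; _∧_; _∨_; not; if_then_else_)
open import Data.Nat using (ℕ; zero; suc; _<ᵇ_; _≡ᵇ_; _⊔_; _∸_)
open import Data.List using (List; []; _∷_; map; concatMap; _++_; length; foldr; upTo; filterᵇ)
open import Data.Bool.ListAction using (all; any)
open import Data.Integer using (ℤ; +_; -[1+_]) renaming (_+_ to _+ℤ_; _*_ to _*ℤ_; _-_ to _-ℤ_)

-- Words are lists of naturals; positions are 0-based internally
-- (position p here corresponds to index p+1 in the paper).

-- entry at position p (default 0 out of range; only used in range)
at : List ℕ → ℕ → ℕ
at []       _       = 0
at (a ∷ xs) zero    = a
at (a ∷ xs) (suc p) = at xs p

range1 : ℕ → List ℕ
range1 m = map suc (upTo m)

words : ℕ → ℕ → List (List ℕ)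
words m zero    = [] ∷ []
words m (suc k) = concatMap (λ v → map (v ∷_) (words m k)) (range1 m)

endofunctions : ℕ → List (List ℕ)
endofunctions n = words n n

elemᵇ : ℕ → List ℕ → Bool
elemᵇ v xs = any (v ≡ᵇ_) xs

maxL : List ℕ → ℕ
maxL = foldr _⊔_ 0

isCayley : List ℕ → Bool
isCayley x = all (λ v → elemᵇ v x) (range1 (maxL x))

takeL : ℕ → List ℕ → List ℕ
takeL zero    _        = []
takeL (suc p) []       = []
takeL (suc p) (a ∷ xs) = a ∷ takeL p xs

-- position p ∈ Ascbot(x): p = 0 (index 1), or p is the bottom of an
-- ascent, i.e. p+1 < length x and x_p < x_{p+1}
inAscbot : List ℕ → ℕ → Bool
inAscbot x zero    = true
inAscbot x (suc p) = (suc (suc p) <ᵇ suc (length x)) ∧ (at x (suc p) <ᵇ at x (suc (suc p)))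

inNub : List ℕ → ℕ → Bool
inNub x p = not (elemᵇ (at x p) (takeL p x))

_⇔ᵇ_ : Bool → Bool → Bool
true  ⇔ᵇ b = b
false ⇔ᵇ b = not b

ascbotEqNub : List ℕ → Bool
ascbotEqNub x = all (λ p → inAscbot x p ⇔ᵇ inNub x p) (upTo (length x))

isRevisedAscentSeq : List ℕ → Bool
isRevisedAscentSeq x = isCayley x ∧ ascbotEqNub x

subseqs : ℕ → List ℕ → List (List ℕ)
subseqs zero    _        = [] ∷ []
subseqs (suc k) []       = []
subseqs (suc k) (a ∷ xs) = map (a ∷_) (subseqs k xs) ++ subseqs (suc k) xs

orderIso : List ℕ → List ℕ → Bool
orderIso u σ =
  all (λ s → all (λ t →
        ((at u s <ᵇ at u t) ⇔ᵇ (at σ s <ᵇ at σ t)) ∧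
        ((at u s ≡ᵇ at u t) ⇔ᵇ (at σ s ≡ᵇ at σ t)))
      (upTo (length σ))) (upTo (length σ))

contains : List ℕ → List ℕ → Bool
contains x σ = any (λ u → orderIso u σ) (subseqs (length σ) x)

avoids : List ℕ → List ℕ → Bool
avoids x σ = not (contains x σ)

hatB : ℕ → List ℕ → List (List ℕ)
hatB n σ = filterᵇ (λ x → isRevisedAscentSeq x ∧ avoids x σ) (endofunctions n)

PS : Set
PS = ℕ → ℤ

sumℤ : List ℤ → ℤ
sumℤ = foldr _+ℤ_ (+ 0)

_⊕_ : PS → PS → PS
(f ⊕ g) n = f n +ℤ g n

_⊖_ : PS → PS → PS
(f ⊖ g) n = f n -ℤ g n

_⊛_ : PS → PS → PS
(f ⊛ g) n = sumℤ (map (λ k → f k *ℤ g (n ∸ k)) (upTo (suc n)))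

poly : List ℤ → PS
poly []       _       = + 0
poly (c ∷ cs) zero    = c
poly (c ∷ cs) (suc n) = poly cs n

F123 : PS
F123 zero    = + 0
F123 (suc n) = + length (hatB (suc n) (1 ∷ 2 ∷ 3 ∷ []))

module Submission where

-- Reading a word from left to right, which letters may follow a prefix of a 123-avoiding revised
-- ascent sequence depends only on its minimum v and a small state: whether the last letter is a
-- repeated minimum, a new minimum (which must be followed by an ascent) or a repeated letter
-- v + d, and the headroom above which a letter would complete a 123. The first letter is the
-- maximum, and the Cayley condition forces each new minimum to lie just below the previous one.
-- So b n = |B̂ₙ₊₁(123)| counts walks of length n in an explicit graph on these states, once one
-- sums over the starting minimum to lift the constraint v ≥ 1. Raising the headroom by one
-- changes walk counts by a convolution with q, the counts from "one above the minimum"; this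
-- yields q (n+3) = 2 q (n+2) + q (n+1) + Σᵢ q i q (n-i) and b (n+2) = b (n+1) + q n. Hence
-- 2(t-1)F - (t²-1) = 1 - 2t - t² - 2t³Q(t), and the recurrence for q says exactly that its
-- square is t⁴ + 2t² - 4t + 1.

open import Defs
open import Data.Bool using (Bool; true; false; _∧_; _∨_; not; if_then_else_)
open import Data.Bool.Properties
  using (∨-assoc; ∨-zeroʳ; ∧-zeroʳ; ∨-identityʳ; ∧-identityʳ; ∧-assoc; ∧-distribˡ-∨)
open import Data.Bool.ListAction using (all; any)
open import Data.Bool.Solver using (module ∨-∧-Solver)
open import Data.Empty using (⊥-elim)
open import Data.Maybe using (Maybe; just; nothing)
open import Function using (_∘_)
open import Data.List using (List; []; _∷_; _∷ʳ_; _++_; map; length; upTo; applyUpTo; concatMap; filterᵇ)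
open import Data.List.Properties
  using (++-assoc; ++-identityʳ; map-upTo; map-applyUpTo; map-++; upTo-∷ʳ; map-∘; map-cong)
open import Data.Nat.ListAction using (sum)
open import Data.Nat.ListAction.Properties using (sum-++)
open import Data.Nat
open import Data.Nat.Properties
open import Data.Product using (Σ-syntax; _×_; _,_; proj₁; proj₂)
open import Data.Sum using (_⊎_; inj₁; inj₂; [_,_]′)
open import Relation.Binary.PropositionalEquality
open import Relation.Binary.Definitions using (tri<; tri≈; tri>)
open import Relation.Nullary using (yes; no)
open import Algebra.Properties.CommutativeSemigroup +-commutativeSemigroup using (interchange)
open import Data.Nat.Tactic.RingSolver using (solve-∀)

open ∨-∧-Solver using (solve; _:+_; _:*_; _:=_; con)

<⇒<ᵇ≡true : ∀ {m n} → m < n → (m <ᵇ n) ≡ true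
<⇒<ᵇ≡true {zero}  {suc n} _       = refl
<⇒<ᵇ≡true {suc m} {suc n} (s≤s p) = <⇒<ᵇ≡true p

≥⇒<ᵇ≡false : ∀ {m n} → n ≤ m → (m <ᵇ n) ≡ false
≥⇒<ᵇ≡false {n = zero}      _       = refl
≥⇒<ᵇ≡false {suc m} {suc n} (s≤s p) = ≥⇒<ᵇ≡false p

<ᵇ≡true⇒< : ∀ {m n} → (m <ᵇ n) ≡ true → m < n
<ᵇ≡true⇒< {zero}  {suc n} _ = z<s
<ᵇ≡true⇒< {suc m} {suc n} p = s<s (<ᵇ≡true⇒< p)

<ᵇ≡false⇒≥ : ∀ {m n} → (m <ᵇ n) ≡ false → n ≤ m
<ᵇ≡false⇒≥ {n = zero}      _ = z≤n
<ᵇ≡false⇒≥ {suc m} {suc n} p = s≤s (<ᵇ≡false⇒≥ p)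

<ᵇ-irrefl : ∀ m → (m <ᵇ m) ≡ false
<ᵇ-irrefl m = ≥⇒<ᵇ≡false (≤-refl {m})

≡ᵇ-refl : ∀ m → (m ≡ᵇ m) ≡ true
≡ᵇ-refl zero    = refl
≡ᵇ-refl (suc m) = ≡ᵇ-refl m

≡ᵇ≡true⇒≡ : ∀ {m n} → (m ≡ᵇ n) ≡ true → m ≡ n
≡ᵇ≡true⇒≡ {zero}  {zero}  _ = refl
≡ᵇ≡true⇒≡ {suc m} {suc n} p = cong suc (≡ᵇ≡true⇒≡ p)

≢⇒≡ᵇ≡false : ∀ {m n} → m ≢ n → (m ≡ᵇ n) ≡ false
≢⇒≡ᵇ≡false {zero}  {zero}  m≢n = ⊥-elim (m≢n refl)
≢⇒≡ᵇ≡false {zero}  {suc n} _   = refl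
≢⇒≡ᵇ≡false {suc m} {zero}  _   = refl
≢⇒≡ᵇ≡false {suc m} {suc n} m≢n = ≢⇒≡ᵇ≡false (m≢n ∘ cong suc)

∨-trueˡ : ∀ {a} b → a ≡ true → a ∨ b ≡ true
∨-trueˡ b refl = refl

∨-trueʳ : ∀ a {b} → b ≡ true → a ∨ b ≡ true
∨-trueʳ a refl = ∨-zeroʳ a

∨-true⁻ : ∀ a {b} → a ∨ b ≡ true → a ≡ true ⊎ b ≡ true
∨-true⁻ true  _ = inj₁ refl
∨-true⁻ false p = inj₂ p

∧-true⁻ : ∀ a {b} → a ∧ b ≡ true → a ≡ true × b ≡ true
∧-true⁻ true p = refl , p

∧-falseˡ : ∀ {a} b → a ≡ false → a ∧ b ≡ false
∧-falseˡ b refl = refl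

∧-falseʳ : ∀ a {b} → b ≡ false → a ∧ b ≡ false
∧-falseʳ a refl = ∧-zeroʳ a

∨-false : ∀ {a b} → a ≡ false → b ≡ false → a ∨ b ≡ false
∨-false refl refl = refl

true≢false : ∀ {b} → b ≡ true → b ≢ false
true≢false refl ()

if-true : ∀ {A : Set} {b} (x y : A) → b ≡ true → (if b then x else y) ≡ x
if-true x y refl = refl

any-++ : ∀ {A : Set} (f : A → Bool) xs ys → any f (xs ++ ys) ≡ any f xs ∨ any f ys
any-++ f []       ys = refl
any-++ f (x ∷ xs) ys = trans (cong (f x ∨_) (any-++ f xs ys)) (sym (∨-assoc (f x) (any f xs) (any f ys)))

any-++⁺ˡ : ∀ {A : Set} (f : A → Bool) xs ys → any f xs ≡ true → any f (xs ++ ys) ≡ true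
any-++⁺ˡ f xs ys h = trans (any-++ f xs ys) (∨-trueˡ (any f ys) h)

any-map : ∀ {A B : Set} (f : B → Bool) (g : A → B) xs → any f (map g xs) ≡ any (f ∘ g) xs
any-map f g []       = refl
any-map f g (x ∷ xs) = cong (f (g x) ∨_) (any-map f g xs)

all-map : ∀ {A B : Set} (f : B → Bool) (g : A → B) xs → all f (map g xs) ≡ all (f ∘ g) xs
all-map f g []       = refl
all-map f g (x ∷ xs) = cong (f (g x) ∧_) (all-map f g xs)

all-cong : ∀ {A : Set} {f g : A → Bool} xs → (∀ x → f x ≡ g x) → all f xs ≡ all g xs
all-cong []       e = refl
all-cong (x ∷ xs) e = cong₂ _∧_ (e x) (all-cong xs e)

all-upTo-suc : ∀ (f : ℕ → Bool) n → all f (upTo (suc n)) ≡ f 0 ∧ all (f ∘ suc) (upTo n)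
all-upTo-suc f n = cong (f 0 ∧_) (trans (cong (all f) (sym (map-upTo suc n))) (all-map f suc (upTo n)))

all-applyUpTo⁻ : ∀ (f : ℕ → Bool) g n → all f (applyUpTo g n) ≡ true → ∀ i → i < n → f (g i) ≡ true
all-applyUpTo⁻ f g (suc n) h zero    _         = proj₁ (∧-true⁻ (f (g 0)) h)
all-applyUpTo⁻ f g (suc n) h (suc i) (s≤s i<n) = all-applyUpTo⁻ f (g ∘ suc) n (proj₂ (∧-true⁻ (f (g 0)) h)) i i<n

all-applyUpTo⁺ : ∀ (f : ℕ → Bool) g n → (∀ i → i < n → f (g i) ≡ true) → all f (applyUpTo g n) ≡ true
all-applyUpTo⁺ f g zero    h = refl
all-applyUpTo⁺ f g (suc n) h rewrite h 0 z<s = all-applyUpTo⁺ f (g ∘ suc) n (λ i i<n → h (suc i) (s≤s i<n))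

elem-++ : ∀ v xs ys → elemᵇ v (xs ++ ys) ≡ elemᵇ v xs ∨ elemᵇ v ys
elem-++ v = any-++ (v ≡ᵇ_)

elem-here : ∀ a xs → elemᵇ a (a ∷ xs) ≡ true
elem-here a xs rewrite ≡ᵇ-refl a = refl

elem-++⁺ˡ : ∀ v xs ys → elemᵇ v xs ≡ true → elemᵇ v (xs ++ ys) ≡ true
elem-++⁺ˡ v = any-++⁺ˡ (v ≡ᵇ_)

elem-∷ʳ : ∀ a xs → elemᵇ a (xs ∷ʳ a) ≡ true
elem-∷ʳ a xs = trans (elem-++ a xs (a ∷ [])) (∨-trueʳ (elemᵇ a xs) (elem-here a []))

elem-∷⁻ : ∀ y a p → elemᵇ y (a ∷ p) ≡ true → y ≡ a ⊎ elemᵇ y p ≡ true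
elem-∷⁻ y a p h with ∨-true⁻ (y ≡ᵇ a) h
... | inj₁ e = inj₁ (≡ᵇ≡true⇒≡ e)
... | inj₂ e = inj₂ e

elem-∷ʳ⁻ : ∀ y p x → elemᵇ y (p ∷ʳ x) ≡ true → y ≡ x ⊎ elemᵇ y p ≡ true
elem-∷ʳ⁻ y p x h with ∨-true⁻ (elemᵇ y p) (trans (sym (elem-++ y p (x ∷ []))) h)
... | inj₁ e = inj₂ e
... | inj₂ e = [ inj₁ , (λ ()) ]′ (elem-∷⁻ y x [] e)

elem-split : ∀ u w → elemᵇ u w ≡ true →
  Σ[ w₁ ∈ List ℕ ] Σ[ w₂ ∈ List ℕ ] (w ≡ w₁ ++ u ∷ w₂ × elemᵇ u w₁ ≡ false)
elem-split u (c ∷ w) h with u ≡ᵇ c in e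
... | true rewrite ≡ᵇ≡true⇒≡ {u} {c} e = [] , w , refl , refl
... | false with elem-split u w h
...   | w₁ , w₂ , refl , u∉w₁ = c ∷ w₁ , w₂ , refl , trans (cong (_∨ elemᵇ u w₁) e) u∉w₁

anyAbove anyBelow : ℕ → List ℕ → Bool
anyAbove b ys = any (b <ᵇ_) ys
anyBelow b ys = any (_<ᵇ b) ys

AllGE : ℕ → List ℕ → Set
AllGE v p = ∀ y → elemᵇ y p ≡ true → v ≤ y

AllGE⇒elem≡false : ∀ {x v} p → AllGE v p → x < v → elemᵇ x p ≡ false
AllGE⇒elem≡false {x} p ge x<v with elemᵇ x p in e
... | false = refl
... | true  = ⊥-elim (<⇒≱ x<v (ge x e))

AllGE⇒anyBelow≡false : ∀ x p → AllGE x p → anyBelow x p ≡ false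
AllGE⇒anyBelow≡false x []      ge = refl
AllGE⇒anyBelow≡false x (a ∷ p) ge rewrite ≥⇒<ᵇ≡false (ge a (elem-here a p)) =
  AllGE⇒anyBelow≡false x p (λ y e → ge y (∨-trueʳ (y ≡ᵇ a) e))

anyBelow-intro : ∀ x p y → elemᵇ y p ≡ true → y < x → anyBelow x p ≡ true
anyBelow-intro x (a ∷ p) y e y<x with elem-∷⁻ y a p e
... | inj₁ refl rewrite <⇒<ᵇ≡true y<x = refl
... | inj₂ e′   = ∨-trueʳ (a <ᵇ x) (anyBelow-intro x p y e′ y<x)

maxL-upper : ∀ y z → elemᵇ y z ≡ true → y ≤ maxL z
maxL-upper y (a ∷ z) h with elem-∷⁻ y a z h
... | inj₁ refl = m≤m⊔n a (maxL z)
... | inj₂ e    = ≤-trans (maxL-upper y z e) (m≤n⊔m a (maxL z))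

maxL-least : ∀ z m → (∀ y → elemᵇ y z ≡ true → y ≤ m) → maxL z ≤ m
maxL-least []      m h = z≤n
maxL-least (a ∷ z) m h = ⊔-lub (h a (elem-here a z)) (maxL-least z m (λ y e → h y (∨-trueʳ (y ≡ᵇ a) e)))

isCayley⁻ : ∀ z u → isCayley z ≡ true → 1 ≤ u → u ≤ maxL z → elemᵇ u z ≡ true
isCayley⁻ z (suc u) h _ u<max rewrite all-map (λ v → elemᵇ v z) suc (upTo (maxL z)) =
  all-applyUpTo⁻ (λ v → elemᵇ (suc v) z) (λ i → i) (maxL z) h u u<max

isCayley⁺ : ∀ z → (∀ u → 1 ≤ u → u ≤ maxL z → elemᵇ u z ≡ true) → isCayley z ≡ true
isCayley⁺ z h rewrite all-map (λ v → elemᵇ v z) suc (upTo (maxL z)) =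
  all-applyUpTo⁺ (λ v → elemᵇ (suc v) z) (λ i → i) (maxL z) (λ i i<max → h (suc i) (s≤s z≤n) i<max)

count : ∀ {A : Set} → (A → Bool) → List A → ℕ
count f xs = length (filterᵇ f xs)

count-++ : ∀ {A : Set} (f : A → Bool) xs ys → count f (xs ++ ys) ≡ count f xs + count f ys
count-++ f []       ys = refl
count-++ f (x ∷ xs) ys with f x
... | true  = cong suc (count-++ f xs ys)
... | false = count-++ f xs ys

count-map : ∀ {A B : Set} (f : B → Bool) (g : A → B) xs → count f (map g xs) ≡ count (f ∘ g) xs
count-map f g []       = refl
count-map f g (x ∷ xs) with f (g x)
... | true  = cong suc (count-map f g xs)
... | false = count-map f g xs

count-cong : ∀ {A : Set} {f g : A → Bool} xs → (∀ x → f x ≡ g x) → count f xs ≡ count g xs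
count-cong {f = f} {g} []       e = refl
count-cong {f = f} {g} (x ∷ xs) e with f x | g x | e x
... | true  | true  | _ = cong suc (count-cong xs e)
... | false | false | _ = count-cong xs e

count-none : ∀ {A : Set} (f : A → Bool) xs → (∀ x → f x ≡ false) → count f xs ≡ 0
count-none f []       e = refl
count-none f (x ∷ xs) e with f x | e x
... | false | _ = count-none f xs e

boolToℕ : Bool → ℕ
boolToℕ true  = 1
boolToℕ false = 0

count-single : ∀ {A : Set} (f : A → Bool) a → count f (a ∷ []) ≡ boolToℕ (f a)
count-single f a with f a
... | true  = refl
... | false = refl

sumUpTo : ℕ → (ℕ → ℕ) → ℕ
sumUpTo zero    g = 0
sumUpTo (suc n) g = sumUpTo n g + g (suc n)

range1-suc : ∀ n → range1 (suc n) ≡ 1 ∷ map suc (range1 n)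
range1-suc n = cong (1 ∷_) (trans (map-applyUpTo suc suc n)
                                  (sym (trans (cong (map suc) (map-upTo suc n)) (map-applyUpTo suc suc n))))

sum-range1 : ∀ (g : ℕ → ℕ) n → sum (map g (range1 n)) ≡ sumUpTo n g
sum-range1 g zero    = refl
sum-range1 g (suc n) = begin
  sum (map g (map suc (upTo (suc n))))     ≡⟨ cong (λ l → sum (map g (map suc l))) (upTo-∷ʳ n) ⟨
  sum (map g (map suc (upTo n ∷ʳ n)))      ≡⟨ cong (λ l → sum (map g l)) (map-++ suc (upTo n) (n ∷ [])) ⟩
  sum (map g (range1 n ∷ʳ suc n))          ≡⟨ cong sum (map-++ g (range1 n) (suc n ∷ [])) ⟩
  sum (map g (range1 n) ∷ʳ g (suc n))      ≡⟨ sum-++ (map g (range1 n)) (g (suc n) ∷ []) ⟩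
  sum (map g (range1 n)) + (g (suc n) + 0) ≡⟨ cong₂ _+_ (sum-range1 g n) (+-identityʳ (g (suc n))) ⟩
  sumUpTo n g + g (suc n)                  ∎
  where open ≡-Reasoning

sumUpTo-cong : ∀ n {f g : ℕ → ℕ} → (∀ x → 1 ≤ x → x ≤ n → f x ≡ g x) → sumUpTo n f ≡ sumUpTo n g
sumUpTo-cong zero    e = refl
sumUpTo-cong (suc n) e =
  cong₂ _+_ (sumUpTo-cong n (λ x 1≤x x≤n → e x 1≤x (m≤n⇒m≤1+n x≤n))) (e (suc n) z<s ≤-refl)

sumUpTo-zero : ∀ n {g : ℕ → ℕ} → (∀ x → 1 ≤ x → x ≤ n → g x ≡ 0) → sumUpTo n g ≡ 0
sumUpTo-zero n e = trans (sumUpTo-cong n e) (all-zero n)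
  where
  all-zero : ∀ n → sumUpTo n (λ _ → 0) ≡ 0
  all-zero zero    = refl
  all-zero (suc n) = cong (_+ 0) (all-zero n)

sumUpTo-+ : ∀ m n (g : ℕ → ℕ) → sumUpTo (m + n) g ≡ sumUpTo m g + sumUpTo n (λ i → g (m + i))
sumUpTo-+ m zero    g rewrite +-identityʳ m = sym (+-identityʳ (sumUpTo m g))
sumUpTo-+ m (suc n) g rewrite +-suc m n | sumUpTo-+ m n g = +-assoc (sumUpTo m g) _ _

sumUpTo-tail : ∀ {c n} {g : ℕ → ℕ} → c ≤ n → (∀ x → c < x → g x ≡ 0) → sumUpTo n g ≡ sumUpTo c g
sumUpTo-tail {c} {g = g} c≤n above with m≤n⇒∃[o]m+o≡n c≤n
... | j , refl = trans (sumUpTo-+ c j g)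
                       (trans (cong (sumUpTo c g +_) (sumUpTo-zero j (λ i 1≤i _ → above (c + i) (m<m+n c 1≤i))))
                              (+-identityʳ (sumUpTo c g)))

sumUpTo-suc-shift : ∀ n (g : ℕ → ℕ) → sumUpTo (suc n) g ≡ g 1 + sumUpTo n (g ∘ suc)
sumUpTo-suc-shift zero    g = +-comm 0 (g 1)
sumUpTo-suc-shift (suc n) g rewrite sumUpTo-suc-shift n g = +-assoc (g 1) _ _

sumUpTo-distrib : ∀ n (f g : ℕ → ℕ) → sumUpTo n (λ x → f x + g x) ≡ sumUpTo n f + sumUpTo n g
sumUpTo-distrib zero    f g = refl
sumUpTo-distrib (suc n) f g rewrite sumUpTo-distrib n f g = interchange (sumUpTo n f) (sumUpTo n g) (f (suc n)) (g (suc n))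

sumUpTo-sum : ∀ {A : Set} n (F : A → ℕ → ℕ) ts →
  sumUpTo n (λ x → sum (map (λ t → F t x) ts)) ≡ sum (map (λ t → sumUpTo n (F t)) ts)
sumUpTo-sum n F []       = sumUpTo-zero n (λ _ _ _ → refl)
sumUpTo-sum n F (t ∷ ts) = trans (sumUpTo-distrib n (F t) (λ x → sum (map (λ t → F t x) ts)))
                                 (cong (sumUpTo n (F t) +_) (sumUpTo-sum n F ts))

sum-map-+ : ∀ {A : Set} (f g : A → ℕ) xs → sum (map (λ x → f x + g x) xs) ≡ sum (map f xs) + sum (map g xs)
sum-map-+ f g []       = refl
sum-map-+ f g (x ∷ xs) rewrite sum-map-+ f g xs = interchange (f x) (g x) (sum (map f xs)) (sum (map g xs))

sum-map-*ʳ : ∀ {A : Set} (f : A → ℕ) c xs → sum (map (λ x → f x * c) xs) ≡ sum (map f xs) * c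
sum-map-*ʳ f c []       = refl
sum-map-*ʳ f c (x ∷ xs) = trans (cong (f x * c +_) (sum-map-*ʳ f c xs)) (sym (*-distribʳ-+ c (f x) (sum (map f xs))))

conv : (ℕ → ℕ) → (ℕ → ℕ) → ℕ → ℕ
conv f g zero    = f 0 * g 0
conv f g (suc n) = f 0 * g (suc n) + conv (f ∘ suc) g n

conv-congˡ : ∀ {f f′} g n → (∀ i → f i ≡ f′ i) → conv f g n ≡ conv f′ g n
conv-congˡ g zero    e = cong (_* g 0) (e 0)
conv-congˡ g (suc n) e = cong₂ _+_ (cong (_* g (suc n)) (e 0)) (conv-congˡ g n (e ∘ suc))

sum-conv : ∀ {A : Set} (F : A → ℕ → ℕ) g ts n →
  sum (map (λ t → conv (F t) g n) ts) ≡ conv (λ i → sum (map (λ t → F t i) ts)) g n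
sum-conv F g ts zero    = sum-map-*ʳ (λ t → F t 0) (g 0) ts
sum-conv F g ts (suc n) =
  trans (sum-map-+ (λ t → F t 0 * g (suc n)) (λ t → conv (F t ∘ suc) g n) ts)
        (cong₂ _+_ (sum-map-*ʳ (λ t → F t 0) (g (suc n)) ts) (sum-conv (λ t → F t ∘ suc) g ts n))

-- 123-patterns

σ123 : List ℕ
σ123 = 1 ∷ 2 ∷ 3 ∷ []

-- Comparisons are unchanged by adding 1 to all three entries, so only triples containing 0 are computed.
orderIso-123 : ∀ a b c → orderIso (a ∷ b ∷ c ∷ []) σ123 ≡ (a <ᵇ b) ∧ (b <ᵇ c)
orderIso-123 (suc a) (suc b) (suc c) = orderIso-123 a b c
orderIso-123 zero    zero    c       = refl
orderIso-123 (suc a) zero    c       rewrite <ᵇ-irrefl a | ≡ᵇ-refl a = refl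
orderIso-123 zero    (suc b) zero    = refl
orderIso-123 zero    (suc b) (suc c) rewrite <ᵇ-irrefl b | ≡ᵇ-refl b | <ᵇ-irrefl c | ≡ᵇ-refl c
  with <-cmp b c
... | tri< b<c b≢c _ rewrite <⇒<ᵇ≡true b<c | ≥⇒<ᵇ≡false (<⇒≤ b<c)
                           | ≢⇒≡ᵇ≡false b≢c | ≢⇒≡ᵇ≡false (≢-sym b≢c) = refl
... | tri≈ _ refl _ rewrite <ᵇ-irrefl b = refl
... | tri> _ _ c<b  rewrite ≥⇒<ᵇ≡false (<⇒≤ c<b) = refl
orderIso-123 (suc a) (suc b) zero    rewrite <ᵇ-irrefl a | ≡ᵇ-refl a
  with <-cmp a b
... | tri< a<b a≢b _ rewrite <⇒<ᵇ≡true a<b | ≢⇒≡ᵇ≡false a≢b = refl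
... | tri≈ _ refl _ rewrite <ᵇ-irrefl a = refl
... | tri> _ _ b<a  rewrite ≥⇒<ᵇ≡false (<⇒≤ b<a) = refl

anyBetween : ℕ → ℕ → List ℕ → Bool
anyBetween a c ys = any (λ b → (a <ᵇ b) ∧ (b <ᵇ c)) ys

has12Above : ℕ → List ℕ → Bool
has12Above a []       = false
has12Above a (b ∷ ys) = ((a <ᵇ b) ∧ anyAbove b ys) ∨ has12Above a ys

has123 : List ℕ → Bool
has123 []       = false
has123 (a ∷ ys) = has12Above a ys ∨ has123 ys

completes123 : List ℕ → ℕ → Bool
completes123 []       c = false
completes123 (a ∷ ys) c = anyBetween a c ys ∨ completes123 ys c

contains-123 : ∀ x → contains x σ123 ≡ has123 x
contains-123 []       = refl
contains-123 (a ∷ xs) = begin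
  any iso123 (map (a ∷_) (subseqs 2 xs) ++ subseqs 3 xs)
    ≡⟨ any-++ iso123 (map (a ∷_) (subseqs 2 xs)) (subseqs 3 xs) ⟩
  any iso123 (map (a ∷_) (subseqs 2 xs)) ∨ any iso123 (subseqs 3 xs)
    ≡⟨ cong₂ _∨_ (trans (any-map iso123 (a ∷_) (subseqs 2 xs)) (from a xs)) (contains-123 xs) ⟩
  has12Above a xs ∨ has123 xs ∎
  where
  open ≡-Reasoning
  iso123 : List ℕ → Bool
  iso123 u = orderIso u σ123

  from-pair : ∀ a b ys → any (λ u → iso123 (a ∷ b ∷ u)) (subseqs 1 ys) ≡ (a <ᵇ b) ∧ anyAbove b ys
  from-pair a b []       = sym (∧-zeroʳ (a <ᵇ b))
  from-pair a b (c ∷ ys) = trans (cong₂ _∨_ (orderIso-123 a b c) (from-pair a b ys))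
                                 (sym (∧-distribˡ-∨ (a <ᵇ b) (b <ᵇ c) (anyAbove b ys)))

  from : ∀ a xs → any (λ u → iso123 (a ∷ u)) (subseqs 2 xs) ≡ has12Above a xs
  from a []       = refl
  from a (b ∷ ys) = begin
    any (λ u → iso123 (a ∷ u)) (map (b ∷_) (subseqs 1 ys) ++ subseqs 2 ys)
      ≡⟨ any-++ (λ u → iso123 (a ∷ u)) (map (b ∷_) (subseqs 1 ys)) (subseqs 2 ys) ⟩
    any (λ u → iso123 (a ∷ u)) (map (b ∷_) (subseqs 1 ys)) ∨ any (λ u → iso123 (a ∷ u)) (subseqs 2 ys)
      ≡⟨ cong₂ _∨_ (trans (any-map (λ u → iso123 (a ∷ u)) (b ∷_) (subseqs 1 ys)) (from-pair a b ys))
                   (from a ys) ⟩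
    has12Above a (b ∷ ys) ∎

has12Above-∷ʳ : ∀ a p x → has12Above a (p ∷ʳ x) ≡ has12Above a p ∨ anyBetween a x p
has12Above-∷ʳ a []      x = trans (∨-identityʳ _) (∧-zeroʳ (a <ᵇ x))
has12Above-∷ʳ a (b ∷ p) x
  rewrite has12Above-∷ʳ a p x | any-++ (b <ᵇ_) p (x ∷ [])
  = solve 5 (λ A B C D E → (A :* (B :+ (C :+ con false))) :+ (D :+ E) := ((A :* B) :+ D) :+ ((A :* C) :+ E))
      refl (a <ᵇ b) (anyAbove b p) (b <ᵇ x) (has12Above a p) (anyBetween a x p)

has123-∷ʳ : ∀ p x → has123 (p ∷ʳ x) ≡ has123 p ∨ completes123 p x
has123-∷ʳ []      x = refl
has123-∷ʳ (a ∷ p) x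
  rewrite has12Above-∷ʳ a p x | has123-∷ʳ p x
  = solve 4 (λ A B C D → (A :+ B) :+ (C :+ D) := (A :+ C) :+ (B :+ D))
      refl (has12Above a p) (anyBetween a x p) (has123 p) (completes123 p x)

completes123-∷ʳ : ∀ p x c → completes123 (p ∷ʳ x) c ≡ completes123 p c ∨ ((x <ᵇ c) ∧ anyBelow x p)
completes123-∷ʳ []      x c = sym (∧-zeroʳ (x <ᵇ c))
completes123-∷ʳ (a ∷ p) x c
  rewrite completes123-∷ʳ p x c | any-++ (λ b → (a <ᵇ b) ∧ (b <ᵇ c)) p (x ∷ [])
  = solve 5 (λ A B C D E → (A :+ ((B :* C) :+ con false)) :+ (D :+ (C :* E)) := (A :+ D) :+ (C :* (B :+ E)))
      refl (anyBetween a c p) (a <ᵇ x) (x <ᵇ c) (completes123 p c) (anyBelow x p)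

has12Above-++⁺ˡ : ∀ a u w → has12Above a u ≡ true → has12Above a (u ++ w) ≡ true
has12Above-++⁺ˡ a (b ∷ u) w h with ∨-true⁻ ((a <ᵇ b) ∧ anyAbove b u) h
... | inj₂ h₂ = ∨-trueʳ ((a <ᵇ b) ∧ anyAbove b (u ++ w)) (has12Above-++⁺ˡ a u w h₂)
... | inj₁ h₁ with ∧-true⁻ (a <ᵇ b) h₁
...   | a<b , above rewrite a<b | any-++⁺ˡ (b <ᵇ_) u w above = refl

has123-++⁺ˡ : ∀ u w → has123 u ≡ true → has123 (u ++ w) ≡ true
has123-++⁺ˡ (a ∷ u) w h with ∨-true⁻ (has12Above a u) h
... | inj₁ h₁ = ∨-trueˡ (has123 (u ++ w)) (has12Above-++⁺ˡ a u w h₁)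
... | inj₂ h₂ = ∨-trueʳ (has12Above a (u ++ w)) (has123-++⁺ˡ u w h₂)

completes123-mono : ∀ p {c c′} → c ≤ c′ → completes123 p c ≡ true → completes123 p c′ ≡ true
completes123-mono (a ∷ p) {c} {c′} c≤c′ h with ∨-true⁻ (anyBetween a c p) h
... | inj₂ h₂ = ∨-trueʳ (anyBetween a c′ p) (completes123-mono p c≤c′ h₂)
... | inj₁ h₁ = ∨-trueˡ (completes123 p c′) (between-mono p h₁)
  where
  between-mono : ∀ ys → anyBetween a c ys ≡ true → anyBetween a c′ ys ≡ true
  between-mono (b ∷ ys) h with ∨-true⁻ ((a <ᵇ b) ∧ (b <ᵇ c)) h
  ... | inj₂ h₂ = ∨-trueʳ ((a <ᵇ b) ∧ (b <ᵇ c′)) (between-mono ys h₂)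
  ... | inj₁ h₁ with ∧-true⁻ (a <ᵇ b) h₁
  ...   | a<b , b<c rewrite a<b | <⇒<ᵇ≡true (<-≤-trans (<ᵇ≡true⇒< b<c) c≤c′) = refl

completes123-antimono : ∀ p {c c′} → c ≤ c′ → completes123 p c′ ≡ false → completes123 p c ≡ false
completes123-antimono p {c} c≤c′ h with completes123 p c in e
... | false = refl
... | true  = ⊥-elim (true≢false (completes123-mono p c≤c′ e) h)

completes123⇒has123 : ∀ p x w → completes123 p x ≡ true → has123 (p ++ x ∷ w) ≡ true
completes123⇒has123 p x w h = subst (λ u → has123 u ≡ true) (++-assoc p (x ∷ []) w)
  (has123-++⁺ˡ (p ∷ʳ x) w (trans (has123-∷ʳ p x) (∨-trueʳ (has123 p) h)))

completes123-∷ʳ⁺ : ∀ p x y → completes123 p y ≡ true → completes123 (p ∷ʳ x) y ≡ true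
completes123-∷ʳ⁺ p x y h = trans (completes123-∷ʳ p x y) (∨-trueˡ _ h)

completes123-∷ʳ-new : ∀ p x y → x < y → anyBelow x p ≡ true → completes123 (p ∷ʳ x) y ≡ true
completes123-∷ʳ-new p x y x<y h rewrite completes123-∷ʳ p x y | <⇒<ᵇ≡true x<y | h = ∨-zeroʳ _

-- Ascbot = Nub, read from left to right

-- ascentIffNew seen b c is the condition (i ∈ Ascbot ⇔ i ∈ Nub) at an entry b preceded by seen and
-- followed by c. A last entry is never an ascent bottom, so it must repeat (ascentIffNewFrom).
-- ascentIffNewBefore p c checks every entry of p followed by c except the first, which always passes.
ascentIffNew : List ℕ → ℕ → ℕ → Bool
ascentIffNew seen b c = (b <ᵇ c) ⇔ᵇ not (elemᵇ b seen)

ascentIffNewFrom : List ℕ → ℕ → List ℕ → Bool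
ascentIffNewFrom seen b []       = elemᵇ b seen
ascentIffNewFrom seen b (c ∷ ys) = ascentIffNew seen b c ∧ ascentIffNewFrom (seen ∷ʳ b) c ys

ascentIffNewUntil : List ℕ → ℕ → List ℕ → ℕ → Bool
ascentIffNewUntil seen b []      c = ascentIffNew seen b c
ascentIffNewUntil seen b (d ∷ u) c = ascentIffNew seen b d ∧ ascentIffNewUntil (seen ∷ʳ b) d u c

ascentIffNewBefore : List ℕ → ℕ → Bool
ascentIffNewBefore []          c = true
ascentIffNewBefore (a ∷ [])    c = true
ascentIffNewBefore (a ∷ b ∷ u) c = ascentIffNewUntil (a ∷ []) b u c

ascbotEqNub-∷∷ : ∀ a b ys → ascbotEqNub (a ∷ b ∷ ys) ≡ ascentIffNewFrom (a ∷ []) b ys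
ascbotEqNub-∷∷ a b ys =
  trans (all-upTo-suc (λ p → inAscbot (a ∷ b ∷ ys) p ⇔ᵇ inNub (a ∷ b ∷ ys) p) (suc (length ys)))
        (scan (a ∷ []) b ys)
  where
  holdsAt : List ℕ → List ℕ → ℕ → Bool
  holdsAt seen xs p = ((p <ᵇ length xs) ∧ (at xs p <ᵇ at xs (suc p)))
                      ⇔ᵇ not (elemᵇ (at xs p) (seen ++ takeL p xs))

  holdsAt-suc : ∀ seen b ys p → holdsAt seen (b ∷ ys) (suc p) ≡ holdsAt (seen ∷ʳ b) ys p
  holdsAt-suc seen b ys p rewrite ++-assoc seen (b ∷ []) (takeL p ys) = refl

  false⇔not : ∀ e → (false ⇔ᵇ not e) ≡ e
  false⇔not true  = refl
  false⇔not false = refl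

  scan : ∀ seen b ys → all (holdsAt seen (b ∷ ys)) (upTo (suc (length ys))) ≡ ascentIffNewFrom seen b ys
  scan seen b [] rewrite ++-identityʳ seen = trans (∧-identityʳ _) (false⇔not (elemᵇ b seen))
  scan seen b (c ∷ zs)
    rewrite all-upTo-suc (holdsAt seen (b ∷ c ∷ zs)) (suc (length zs))
          | all-cong (upTo (suc (length zs))) (holdsAt-suc seen b (c ∷ zs))
          | scan (seen ∷ʳ b) c zs | ++-identityʳ seen = refl

ascentIffNewFrom-++ : ∀ seen b u c w →
  ascentIffNewFrom seen b (u ++ c ∷ w) ≡ ascentIffNewUntil seen b u c ∧ ascentIffNewFrom (seen ++ b ∷ u) c w
ascentIffNewFrom-++ seen b []      c w = refl
ascentIffNewFrom-++ seen b (d ∷ u) c w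
  rewrite ascentIffNewFrom-++ (seen ∷ʳ b) d u c w | ++-assoc seen (b ∷ []) (d ∷ u)
  = sym (∧-assoc (ascentIffNew seen b d) _ _)

ascbotEqNub-++ : ∀ a u c w →
  ascbotEqNub ((a ∷ u) ++ c ∷ w) ≡ ascentIffNewBefore (a ∷ u) c ∧ ascentIffNewFrom (a ∷ u) c w
ascbotEqNub-++ a []      c w = ascbotEqNub-∷∷ a c w
ascbotEqNub-++ a (b ∷ u) c w = trans (ascbotEqNub-∷∷ a b (u ++ c ∷ w)) (ascentIffNewFrom-++ (a ∷ []) b u c w)

ascentIffNewUntil-∷ʳ : ∀ seen b u c x →
  ascentIffNewUntil seen b (u ∷ʳ c) x ≡ ascentIffNewUntil seen b u c ∧ ascentIffNew (seen ++ b ∷ u) c x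
ascentIffNewUntil-∷ʳ seen b []      c x = refl
ascentIffNewUntil-∷ʳ seen b (d ∷ u) c x
  rewrite ascentIffNewUntil-∷ʳ (seen ∷ʳ b) d u c x | ++-assoc seen (b ∷ []) (d ∷ u)
  = sym (∧-assoc (ascentIffNew seen b d) _ _)

ascentIffNewBefore-∷ʳ : ∀ a u c x →
  ascentIffNewBefore ((a ∷ u) ∷ʳ c) x ≡ ascentIffNewBefore (a ∷ u) c ∧ ascentIffNew (a ∷ u) c x
ascentIffNewBefore-∷ʳ a []      c x = refl
ascentIffNewBefore-∷ʳ a (b ∷ u) c x = ascentIffNewUntil-∷ʳ (a ∷ []) b u c x

ascentIffNew-old : ∀ q ℓ x → elemᵇ ℓ q ≡ true → ascentIffNew q ℓ x ≡ not (ℓ <ᵇ x)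
ascentIffNew-old q ℓ x old rewrite old with ℓ <ᵇ x
... | true  = refl
... | false = refl

ascentIffNew-new : ∀ q ℓ x → elemᵇ ℓ q ≡ false → ascentIffNew q ℓ x ≡ (ℓ <ᵇ x)
ascentIffNew-new q ℓ x new rewrite new with ℓ <ᵇ x
... | true  = refl
... | false = refl

ascentIffNew-descent : ∀ q ℓ x → elemᵇ ℓ q ≡ true → x ≤ ℓ → ascentIffNew q ℓ x ≡ true
ascentIffNew-descent q ℓ x old x≤ℓ = trans (ascentIffNew-old q ℓ x old) (cong not (≥⇒<ᵇ≡false x≤ℓ))

ascentIffNewBefore-extend : ∀ q ℓ x → ascentIffNewBefore q ℓ ≡ true →
  q ≡ [] ⊎ ascentIffNew q ℓ x ≡ true → ascentIffNewBefore (q ∷ʳ ℓ) x ≡ true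
ascentIffNewBefore-extend []      ℓ x _  _         = refl
ascentIffNewBefore-extend (a ∷ u) ℓ x ok (inj₂ ok′) rewrite ascentIffNewBefore-∷ʳ a u ℓ x | ok | ok′ = refl

ascbotEqNub-∷ʳ-repeat : ∀ q ℓ → ascentIffNewBefore q ℓ ≡ true → q ≡ [] ⊎ elemᵇ ℓ q ≡ true →
  ascbotEqNub (q ∷ʳ ℓ) ≡ true
ascbotEqNub-∷ʳ-repeat []      ℓ _  _         = refl
ascbotEqNub-∷ʳ-repeat (a ∷ u) ℓ ok (inj₂ old) rewrite ascbotEqNub-++ a u ℓ [] | ok | old = refl

-- Prefixes without admissible completion

isRAS123 : List ℕ → Bool
isRAS123 x = isRevisedAscentSeq x ∧ avoids x σ123

isRAS123-ascbot : ∀ x → ascbotEqNub x ≡ false → isRAS123 x ≡ false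
isRAS123-ascbot x h rewrite h = ∧-falseˡ (avoids x σ123) (∧-zeroʳ (isCayley x))

isRAS123-cayley : ∀ x → isCayley x ≡ false → isRAS123 x ≡ false
isRAS123-cayley x h rewrite h = refl

isRAS123-123 : ∀ x → has123 x ≡ true → isRAS123 x ≡ false
isRAS123-123 x h rewrite contains-123 x | h = ∧-zeroʳ (isRevisedAscentSeq x)

isRAS123-intro : ∀ x → isCayley x ≡ true → ascbotEqNub x ≡ true → has123 x ≡ false → isRAS123 x ≡ true
isRAS123-intro x c r h rewrite contains-123 x | c | r | h = refl

-- A first occurrence y must be followed by an ascent y < z, and an earlier value below y
-- then starts a 123.
dies-newAbove : ∀ a u y w → elemᵇ y (a ∷ u) ≡ false → anyBelow y (a ∷ u) ≡ true →
  isRAS123 ((a ∷ u) ++ y ∷ w) ≡ false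
dies-newAbove a u y []      new below =
  isRAS123-ascbot ((a ∷ u) ++ y ∷ []) (trans (ascbotEqNub-++ a u y []) (∧-falseʳ _ new))
dies-newAbove a u y (z ∷ w) new below with y <ᵇ z in y<z
... | false = isRAS123-ascbot ((a ∷ u) ++ y ∷ z ∷ w)
                (trans (ascbotEqNub-++ a u y (z ∷ w))
                       (∧-falseʳ (ascentIffNewBefore (a ∷ u) y)
                                 (∧-falseˡ (ascentIffNewFrom ((a ∷ u) ∷ʳ y) z w) noAscent)))
  where
  noAscent : ascentIffNew (a ∷ u) y z ≡ false
  noAscent rewrite y<z | new = refl
... | true = isRAS123-123 ((a ∷ u) ++ y ∷ z ∷ w)
               (subst (λ t → has123 t ≡ true) (++-assoc (a ∷ u) (y ∷ []) (z ∷ w))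
                      (completes123⇒has123 ((a ∷ u) ∷ʳ y) z w completes))
  where
  completes : completes123 ((a ∷ u) ∷ʳ y) z ≡ true
  completes rewrite completes123-∷ʳ (a ∷ u) y z | y<z | below = ∨-zeroʳ _

occurs-after : ∀ a u v x w → AllGE (suc v) (a ∷ u) → 1 ≤ x → x < v →
  isCayley ((a ∷ u) ++ x ∷ w) ≡ true → elemᵇ v w ≡ true
occurs-after a u v x w ge 1≤x x<v cayley = trans (sym only-in-w) v∈whole
  where
  only-in-w : elemᵇ v ((a ∷ u) ++ x ∷ w) ≡ elemᵇ v w
  only-in-w = trans (elem-++ v (a ∷ u) (x ∷ w))
                    (cong₂ _∨_ (AllGE⇒elem≡false (a ∷ u) ge ≤-refl) (cong (_∨ elemᵇ v w) (≢⇒≡ᵇ≡false (>⇒≢ x<v))))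
  v∈whole : elemᵇ v ((a ∷ u) ++ x ∷ w) ≡ true
  v∈whole = isCayley⁻ ((a ∷ u) ++ x ∷ w) v cayley (≤-trans 1≤x (<⇒≤ x<v))
              (≤-trans (<⇒≤ (ge a (elem-here a u))) (maxL-upper a (a ∷ u ++ x ∷ w) (elem-here a (u ++ x ∷ w))))

-- The first occurrence of v after x is new and above x.
dies-skip : ∀ a u v x w → AllGE v (a ∷ u) → 1 ≤ x → 2 + x ≤ v → isRAS123 ((a ∷ u) ++ x ∷ w) ≡ false
dies-skip a u (suc v) x w ge 1≤x (s≤s x<v) with isRAS123 ((a ∷ u) ++ x ∷ w) in ok
... | false = refl
... | true with elem-split v w (occurs-after a u v x w ge 1≤x x<v (proj₁ (∧-true⁻ _ (proj₁ (∧-true⁻ _ ok)))))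
...   | w₁ , w₂ , refl , v∉w₁ = ⊥-elim (true≢false ok′ (dies-newAbove a (u ++ x ∷ w₁) v w₂ v-new x-below))
  where
  ok′ : isRAS123 ((a ∷ (u ++ x ∷ w₁)) ++ v ∷ w₂) ≡ true
  ok′ rewrite ++-assoc u (x ∷ w₁) (v ∷ w₂) = ok
  v-new : elemᵇ v (a ∷ (u ++ x ∷ w₁)) ≡ false
  v-new rewrite elem-++ v u (x ∷ w₁) | ≢⇒≡ᵇ≡false (>⇒≢ x<v) | v∉w₁ | ∨-identityʳ (elemᵇ v u)
    = AllGE⇒elem≡false (a ∷ u) ge ≤-refl
  x-below : anyBelow v (a ∷ (u ++ x ∷ w₁)) ≡ true
  x-below = anyBelow-intro v (a ∷ (u ++ x ∷ w₁)) x
              (trans (elem-++ x (a ∷ u) (x ∷ w₁)) (∨-trueʳ (elemᵇ x (a ∷ u)) (elem-here x w₁))) x<v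

dies-lastLetter : ∀ a u ℓ x w → ascentIffNew (a ∷ u) ℓ x ≡ false → isRAS123 (((a ∷ u) ∷ʳ ℓ) ++ x ∷ w) ≡ false
dies-lastLetter a u ℓ x w bad = isRAS123-ascbot (((a ∷ u) ∷ʳ ℓ) ++ x ∷ w)
  (trans (ascbotEqNub-++ a (u ∷ʳ ℓ) x w)
         (∧-falseˡ (ascentIffNewFrom (a ∷ (u ∷ʳ ℓ)) x w)
                   (trans (ascentIffNewBefore-∷ʳ a u ℓ x) (∧-falseʳ (ascentIffNewBefore (a ∷ u) ℓ) bad))))

dies-at-last : ∀ {p} q ℓ x w → p ≡ q ∷ʳ ℓ →
  elemᵇ ℓ q ≡ true ⊎ (Σ[ a ∈ ℕ ] Σ[ u ∈ List ℕ ] q ≡ a ∷ u) →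
  ascentIffNew q ℓ x ≡ false → isRAS123 (p ++ x ∷ w) ≡ false
dies-at-last []      ℓ x w _    (inj₁ ())
dies-at-last []      ℓ x w _    (inj₂ (_ , _ , ()))
dies-at-last (a ∷ u) ℓ x w refl _ bad = dies-lastLetter a u ℓ x w bad

-- The automaton

data Offset : Set where
  farBelow justBelow equal : Offset
  over : ℕ → Offset

offset : ℕ → ℕ → Offset
offset zero    zero          = equal
offset zero    (suc zero)    = justBelow
offset zero    (suc (suc _)) = farBelow
offset (suc x) zero          = over x
offset (suc x) (suc v)       = offset x v

data OffsetSpec (x v : ℕ) : Offset → Set where
  farBelow  : 2 + x ≤ v → OffsetSpec x v farBelow
  justBelow : suc x ≡ v → OffsetSpec x v justBelow
  equal     : x ≡ v → OffsetSpec x v equal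
  over      : ∀ i → x ≡ v + suc i → OffsetSpec x v (over i)

offset-spec : ∀ x v → OffsetSpec x v (offset x v)
offset-spec zero    zero          = equal refl
offset-spec zero    (suc zero)    = justBelow refl
offset-spec zero    (suc (suc v)) = farBelow (s≤s (s≤s z≤n))
offset-spec (suc x) zero          = over x refl
offset-spec (suc x) (suc v) with offset x v | offset-spec x v
... | _ | farBelow x+2≤v = farBelow (s≤s x+2≤v)
... | _ | justBelow eq   = justBelow (cong suc eq)
... | _ | equal eq       = equal (cong suc eq)
... | _ | over i eq      = over i (cong suc eq)

offset-farBelow : ∀ x v → 2 + x ≤ v → offset x v ≡ farBelow
offset-farBelow zero    (suc zero)    (s≤s ())
offset-farBelow zero    (suc (suc v)) _         = refl
offset-farBelow (suc x) (suc v)       (s≤s x<v) = offset-farBelow x v x<v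

offset-justBelow : ∀ x → offset x (suc x) ≡ justBelow
offset-justBelow zero    = refl
offset-justBelow (suc x) = offset-justBelow x

offset-equal : ∀ v → offset v v ≡ equal
offset-equal zero    = refl
offset-equal (suc v) = offset-equal v

offset-over : ∀ v i → offset (v + suc i) v ≡ over i
offset-over zero    i = refl
offset-over (suc v) i = offset-over v i

-- The state (s , v) of a prefix with minimum v and first letter m, which is its maximum:
-- repeatMin e: the last letter is v and not a first occurrence, or the prefix is m alone;
-- freshMin e: the last letter is the first occurrence of v;
-- repeatAbove d: the last letter is v + d and not a first occurrence.
-- No letter above cap s v can follow (dies-aboveCap).
data State : Set where
  repeatMin freshMin repeatAbove : ℕ → State

headroom : State → ℕ
headroom (repeatMin e)   = e
headroom (freshMin e)    = suc e
headroom (repeatAbove d) = d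

cap : State → ℕ → ℕ
cap s v = v + headroom s

LastLetter : State → ℕ → List ℕ → ℕ → Set
LastLetter (repeatMin _)   v q ℓ = ℓ ≡ v × (q ≡ [] ⊎ elemᵇ ℓ q ≡ true)
LastLetter (freshMin _)    v q ℓ = ℓ ≡ v × elemᵇ ℓ q ≡ false × Σ[ a ∈ ℕ ] Σ[ u ∈ List ℕ ] q ≡ a ∷ u
LastLetter (repeatAbove d) v q ℓ = ℓ ≡ v + d × elemᵇ ℓ q ≡ true

record InState (m : ℕ) (p : List ℕ) (s : State) (v : ℕ) : Set where
  field
    init       : List ℕ
    last       : ℕ
    p≡init∷ʳlast : p ≡ init ∷ʳ last
    1≤v        : 1 ≤ v
    ≥v         : AllGE v p
    ≤m         : ∀ y → elemᵇ y p ≡ true → y ≤ m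
    interval   : ∀ u → v ≤ u → u ≤ m → elemᵇ u p ≡ true
    cap≤m      : cap s v ≤ m
    no123      : has123 p ≡ false
    cap-free   : completes123 p (cap s v) ≡ false
    above-cap  : ∀ y → cap s v < y → elemᵇ y p ≡ true → completes123 p y ≡ true
    ascents    : ascentIffNewBefore init last ≡ true
    lastLetter : LastLetter s v init last

  last∈p : elemᵇ last p ≡ true
  last∈p rewrite p≡init∷ʳlast = elem-∷ʳ last init

  nonempty : Σ[ a ∈ ℕ ] Σ[ u ∈ List ℕ ] p ≡ a ∷ u
  nonempty with init | p≡init∷ʳlast
  ... | []    | eq = last , [] , eq
  ... | a ∷ u | eq = a , u ∷ʳ last , eq

open InState

inState-first : ∀ m → 1 ≤ m → InState m (m ∷ []) (repeatMin 0) m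
inState-first m 1≤m = record
  { init = [] ; last = m ; p≡init∷ʳlast = refl ; 1≤v = 1≤m
  ; ≥v = λ y e → ≤-reflexive (sym (single e))
  ; ≤m = λ y e → ≤-reflexive (single e)
  ; interval = λ u m≤u u≤m → subst (λ t → elemᵇ t (m ∷ []) ≡ true) (≤-antisym m≤u u≤m) (elem-here m [])
  ; cap≤m = ≤-reflexive (+-identityʳ m)
  ; no123 = refl ; cap-free = refl
  ; above-cap = λ y m<y e → ⊥-elim (<-irrefl (sym (single e)) (subst (_< y) (+-identityʳ m) m<y))
  ; ascents = refl
  ; lastLetter = refl , inj₁ refl }
  where
  single : ∀ {y} → elemᵇ y (m ∷ []) ≡ true → y ≡ m
  single {y} e = [ (λ y≡m → y≡m) , (λ ()) ]′ (elem-∷⁻ y m [] e)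

extend : ∀ {m p s v} (I : InState m p s v) x s′ v′ →
  1 ≤ v′ → v′ ≤ v → v′ ≤ x → x ≤ cap s v → cap s′ v′ ≤ cap s v →
  (∀ u → v′ ≤ u → u < v → u ≡ x) →
  ((x <ᵇ cap s′ v′) ∧ anyBelow x p) ≡ false →
  (∀ y → cap s′ v′ < y → elemᵇ y (p ∷ʳ x) ≡ true → completes123 (p ∷ʳ x) y ≡ true) →
  ascentIffNewBefore p x ≡ true →
  LastLetter s′ v′ p x →
  InState m (p ∷ʳ x) s′ v′
extend {m} {p} {s} {v} I x s′ v′ 1≤v′ v′≤v v′≤x x≤cap cap′≤cap fill no-threat blocked ok last′ = record
  { init = p ; last = x ; p≡init∷ʳlast = refl ; 1≤v = 1≤v′
  ; ≥v = λ y e → [ (λ { refl → v′≤x }) , (λ e′ → ≤-trans v′≤v (≥v I y e′)) ]′ (elem-∷ʳ⁻ y p x e)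
  ; ≤m = λ y e → [ (λ { refl → ≤-trans x≤cap (cap≤m I) }) , ≤m I y ]′ (elem-∷ʳ⁻ y p x e)
  ; interval = interval′
  ; cap≤m = ≤-trans cap′≤cap (cap≤m I)
  ; no123 = trans (has123-∷ʳ p x) (∨-false (no123 I) (completes123-antimono p x≤cap (cap-free I)))
  ; cap-free = trans (completes123-∷ʳ p x (cap s′ v′))
                     (∨-false (completes123-antimono p cap′≤cap (cap-free I)) no-threat)
  ; above-cap = blocked
  ; ascents = ok
  ; lastLetter = last′ }
  where
  interval′ : ∀ u → v′ ≤ u → u ≤ m → elemᵇ u (p ∷ʳ x) ≡ true
  interval′ u v′≤u u≤m with v ≤? u
  ... | yes v≤u = elem-++⁺ˡ u p (x ∷ []) (interval I u v≤u u≤m)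
  ... | no  v≰u rewrite fill u v′≤u (≰⇒> v≰u) = elem-∷ʳ x p

extend-min : ∀ {m p s v} (I : InState m p s v) → ascentIffNewBefore p v ≡ true →
  InState m (p ∷ʳ v) (repeatMin (headroom s)) v
extend-min {p = p} {s} {v} I ok =
  extend I v (repeatMin (headroom s)) v (1≤v I) ≤-refl ≤-refl v≤cap ≤-refl
    (λ u v≤u u<v → ⊥-elim (<⇒≱ u<v v≤u))
    (∧-falseʳ _ (AllGE⇒anyBelow≡false v p (≥v I)))
    blocked ok (refl , inj₂ (interval I v ≤-refl (≤-trans v≤cap (cap≤m I))))
  where
  v≤cap = m≤m+n v (headroom s)
  blocked : ∀ y → cap s v < y → elemᵇ y (p ∷ʳ v) ≡ true → completes123 (p ∷ʳ v) y ≡ true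
  blocked y cap<y e with elem-∷ʳ⁻ y p v e
  ... | inj₁ refl = ⊥-elim (<⇒≱ cap<y v≤cap)
  ... | inj₂ y∈p  = completes123-∷ʳ⁺ p v y (above-cap I y cap<y y∈p)

extend-newMin : ∀ {m p s x} (I : InState m p s (suc x)) → 1 ≤ x → ascentIffNewBefore p x ≡ true →
  InState m (p ∷ʳ x) (freshMin (headroom s)) x
extend-newMin {p = p} {s} {x} I 1≤x ok =
  extend I x (freshMin (headroom s)) x 1≤x (n≤1+n x) ≤-refl x≤cap (≤-reflexive (+-suc x (headroom s)))
    (λ u x≤u u<sx → ≤-antisym (s≤s⁻¹ u<sx) x≤u)
    (∧-falseʳ _ (AllGE⇒anyBelow≡false x p (λ y e → ≤-trans (n≤1+n x) (≥v I y e))))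
    blocked ok (refl , AllGE⇒elem≡false p (≥v I) ≤-refl , nonempty I)
  where
  x≤cap = ≤-trans (n≤1+n x) (m≤m+n (suc x) (headroom s))
  blocked : ∀ y → x + suc (headroom s) < y → elemᵇ y (p ∷ʳ x) ≡ true → completes123 (p ∷ʳ x) y ≡ true
  blocked y cap<y e with elem-∷ʳ⁻ y p x e
  ... | inj₁ refl = ⊥-elim (<⇒≱ cap<y (m≤m+n x (suc (headroom s))))
  ... | inj₂ y∈p  = completes123-∷ʳ⁺ p x y (above-cap I y (subst (_< y) (+-suc x (headroom s)) cap<y) y∈p)

extend-above : ∀ {m p s v i} (I : InState m p s v) → i < headroom s → ascentIffNewBefore p (v + suc i) ≡ true →
  InState m (p ∷ʳ (v + suc i)) (repeatAbove (suc i)) v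
extend-above {p = p} {s} {v} {i} I i<h ok =
  extend I x (repeatAbove (suc i)) v (1≤v I) ≤-refl v≤x x≤cap x≤cap
    (λ u v≤u u<v → ⊥-elim (<⇒≱ u<v v≤u))
    (∧-falseˡ _ (<ᵇ-irrefl x))
    (λ y x<y _ → completes123-∷ʳ-new p x y x<y (anyBelow-intro x p v v∈p v<x))
    ok (refl , interval I x v≤x (≤-trans x≤cap (cap≤m I)))
  where
  x = v + suc i
  v<x = m<m+n v z<s
  v≤x = <⇒≤ v<x
  x≤cap = +-monoʳ-≤ v i<h
  v∈p = interval I v ≤-refl (≤-trans (<⇒≤ v<x) (≤-trans x≤cap (cap≤m I)))

ascents-next : ∀ {m p s v} x (I : InState m p s v) →
  init I ≡ [] ⊎ ascentIffNew (init I) (last I) x ≡ true → ascentIffNewBefore p x ≡ true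
ascents-next x I h = subst (λ t → ascentIffNewBefore t x ≡ true) (sym (p≡init∷ʳlast I))
                           (ascentIffNewBefore-extend (init I) (last I) x (ascents I) h)

AllowedAfterLast : State → ℕ → ℕ → Set
AllowedAfterLast (repeatMin _)   v x = x ≤ v
AllowedAfterLast (freshMin _)    v x = v < x
AllowedAfterLast (repeatAbove d) v x = x ≤ v + d

ascents-allowed : ∀ {m p s v x} (I : InState m p s v) → AllowedAfterLast s v x → ascentIffNewBefore p x ≡ true
ascents-allowed {s = repeatMin _} {x = x} I x≤v with lastLetter I
... | refl , inj₁ init≡[] = ascents-next x I (inj₁ init≡[])
... | refl , inj₂ old     = ascents-next x I (inj₂ (ascentIffNew-descent (init I) (last I) x old x≤v))
ascents-allowed {s = freshMin _} {x = x} I v<x with lastLetter I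
... | refl , new , _ = ascents-next x I (inj₂ (trans (ascentIffNew-new (init I) (last I) x new) (<⇒<ᵇ≡true v<x)))
ascents-allowed {s = repeatAbove _} {x = x} I x≤ℓ with lastLetter I
... | refl , old = ascents-next x I (inj₂ (ascentIffNew-descent (init I) (last I) x old x≤ℓ))

move : State → ℕ → ℕ → Offset → Maybe (State × ℕ)
move (repeatMin e)   v x equal     = just (repeatMin e , v)
move (repeatMin e)   v x justBelow = just (freshMin e , x)
move (repeatMin e)   v x _         = nothing
move (freshMin e)    v x (over i)  = if i <ᵇ suc e then just (repeatAbove (suc i) , v) else nothing
move (freshMin e)    v x _         = nothing
move (repeatAbove d) v x equal     = just (repeatMin d , v)
move (repeatAbove d) v x justBelow = just (freshMin d , x)
move (repeatAbove d) v x (over i)  = if i <ᵇ d then just (repeatAbove (suc i) , v) else nothing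
move (repeatAbove d) v x farBelow  = nothing

transition : State → ℕ → ℕ → Maybe (State × ℕ)
transition s v x = move s v x (offset x v)

step : ∀ {m p s v x s′ v′} → InState m p s v → 1 ≤ x → transition s v x ≡ just (s′ , v′) →
  InState m (p ∷ʳ x) s′ v′
step {s = s} {v} {x} I 1≤x eq with offset x v | offset-spec x v
step {s = repeatMin e}   I 1≤x refl | equal     | equal refl     = extend-min I (ascents-allowed I ≤-refl)
step {s = repeatMin e}   I 1≤x refl | justBelow | justBelow refl = extend-newMin I 1≤x (ascents-allowed I (n≤1+n _))
step {s = repeatMin e}   I 1≤x ()   | farBelow  | _
step {s = repeatMin e}   I 1≤x ()   | over _    | _
step {s = freshMin e}    I 1≤x ()   | farBelow  | _
step {s = freshMin e}    I 1≤x ()   | justBelow | _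
step {s = freshMin e}    I 1≤x ()   | equal     | _
step {s = freshMin e} {v} I 1≤x eq  | over i    | over .i refl with i <ᵇ suc e in i<h | eq
... | true  | refl = extend-above I (<ᵇ≡true⇒< i<h) (ascents-allowed I (m<m+n v z<s))
... | false | ()
step {s = repeatAbove d} I 1≤x refl | equal     | equal refl     = extend-min I (ascents-allowed I (m≤m+n _ d))
step {s = repeatAbove d} I 1≤x refl | justBelow | justBelow refl =
  extend-newMin I 1≤x (ascents-allowed I (≤-trans (n≤1+n _) (m≤m+n _ d)))
step {s = repeatAbove d} I 1≤x ()   | farBelow  | _
step {s = repeatAbove d} {v} I 1≤x eq | over i  | over .i refl with i <ᵇ d in i<d | eq
... | true  | refl = extend-above I (<ᵇ≡true⇒< i<d) (ascents-allowed I (+-monoʳ-≤ v (<ᵇ≡true⇒< i<d)))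
... | false | ()

dies-skipping : ∀ {m p s v x} w → InState m p s v → 1 ≤ x → 2 + x ≤ v → isRAS123 (p ++ x ∷ w) ≡ false
dies-skipping {x = x} w I 1≤x x+2≤v with nonempty I
... | a , u , refl = dies-skip a u _ x w (≥v I) 1≤x x+2≤v

dies-aboveCap : ∀ {m p s v x} w → InState m p s v → cap s v < x → isRAS123 (p ++ x ∷ w) ≡ false
dies-aboveCap {p = p} {s} {v} {x} w I cap<x with elemᵇ x p in x∈p
... | true  = isRAS123-123 (p ++ x ∷ w) (completes123⇒has123 p x w (above-cap I x cap<x x∈p))
... | false with nonempty I
...   | a , u , refl = dies-newAbove a u x w x∈p (anyBelow-intro x p v v∈p v<x)
  where
  v<x = ≤-<-trans (m≤m+n v (headroom s)) cap<x
  v∈p = interval I v ≤-refl (≤-trans (m≤m+n v (headroom s)) (cap≤m I))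

dies-freshNoAscent : ∀ {m p e v x} w → InState m p (freshMin e) v → x ≤ v → isRAS123 (p ++ x ∷ w) ≡ false
dies-freshNoAscent {x = x} w I x≤v with lastLetter I
... | refl , new , nonempty-init =
  dies-at-last (init I) (last I) x w (p≡init∷ʳlast I) (inj₂ nonempty-init)
    (trans (ascentIffNew-new (init I) (last I) x new) (≥⇒<ᵇ≡false x≤v))

dies-ascentFromMin : ∀ {m p e v x} w → InState m p (repeatMin e) v → v < x → isRAS123 (p ++ x ∷ w) ≡ false
dies-ascentFromMin {x = x} w I v<x with lastLetter I
... | refl , inj₂ old =
  dies-at-last (init I) (last I) x w (p≡init∷ʳlast I) (inj₁ old)
    (trans (ascentIffNew-old (init I) (last I) x old) (cong not (<⇒<ᵇ≡true v<x)))
... | refl , inj₁ init≡[] =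
  subst (λ t → isRAS123 (t ++ x ∷ w) ≡ false) (sym p≡[ℓ])
        (dies-newAbove (last I) [] x w x∉[ℓ] (anyBelow-intro x (last I ∷ []) (last I) (elem-here (last I) []) v<x))
  where
  p≡[ℓ] = trans (p≡init∷ʳlast I) (cong (_∷ʳ last I) init≡[])
  x∉[ℓ] : elemᵇ x (last I ∷ []) ≡ false
  x∉[ℓ] rewrite ≢⇒≡ᵇ≡false (≢-sym (<⇒≢ v<x)) = refl

dies : ∀ {m p s v x} → InState m p s v → 1 ≤ x → transition s v x ≡ nothing →
  ∀ w → isRAS123 (p ++ x ∷ w) ≡ false
dies {s = s} {v} {x} I 1≤x eq w with offset x v | offset-spec x v
dies {s = repeatMin e}   I 1≤x _  w | farBelow  | farBelow x+2≤v = dies-skipping w I 1≤x x+2≤v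
dies {s = repeatMin e}   I 1≤x () w | justBelow | _
dies {s = repeatMin e}   I 1≤x () w | equal     | _
dies {s = repeatMin e}   {v} I 1≤x _ w | over i | over .i refl = dies-ascentFromMin w I (m<m+n v z<s)
dies {s = freshMin e}    I 1≤x _  w | farBelow  | farBelow x+2≤v =
  dies-freshNoAscent w I (≤-trans (n≤1+n _) (<⇒≤ x+2≤v))
dies {s = freshMin e}    I 1≤x _  w | justBelow | justBelow refl = dies-freshNoAscent w I (n≤1+n _)
dies {s = freshMin e}    I 1≤x _  w | equal     | equal refl     = dies-freshNoAscent w I ≤-refl
dies {s = freshMin e} {v} I 1≤x eq w | over i   | over .i refl with i <ᵇ suc e in i<h | eq
... | false | _ = dies-aboveCap w I (+-monoʳ-< v (s≤s (<ᵇ≡false⇒≥ i<h)))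
dies {s = repeatAbove d} I 1≤x _  w | farBelow  | farBelow x+2≤v = dies-skipping w I 1≤x x+2≤v
dies {s = repeatAbove d} I 1≤x () w | justBelow | _
dies {s = repeatAbove d} I 1≤x () w | equal     | _
dies {s = repeatAbove d} {v} I 1≤x eq w | over i | over .i refl with i <ᵇ d in i<d | eq
... | false | _ = dies-aboveCap w I (+-monoʳ-< v (s≤s (<ᵇ≡false⇒≥ i<d)))

accepting : State → ℕ → Bool
accepting (freshMin _) _ = false
accepting _            1 = true
accepting _            _ = false

isCayley-min1 : ∀ {m p s} → InState m p s 1 → isCayley p ≡ true
isCayley-min1 {m} {p} I = isCayley⁺ p (λ u 1≤u u≤max → interval I u 1≤u (≤-trans u≤max (maxL-least p m (≤m I))))

isCayley-min≥2 : ∀ {m p s v} → InState m p s v → 2 ≤ v → isCayley p ≡ false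
isCayley-min≥2 {p = p} I 2≤v with isCayley p in cayley
... | false = refl
... | true  = ⊥-elim (<⇒≱ 2≤v (≥v I 1 (isCayley⁻ p 1 cayley ≤-refl 1≤max)))
  where
  1≤max = ≤-trans (≤-trans (1≤v I) (≥v I (last I) (last∈p I))) (maxL-upper (last I) p (last∈p I))

isRAS123-repeat : ∀ {m p s} (I : InState m p s 1) → init I ≡ [] ⊎ elemᵇ (last I) (init I) ≡ true →
  isRAS123 p ≡ true
isRAS123-repeat {p = p} I repeat = isRAS123-intro p (isCayley-min1 I)
  (trans (cong ascbotEqNub (p≡init∷ʳlast I)) (ascbotEqNub-∷ʳ-repeat (init I) (last I) (ascents I) repeat))
  (no123 I)

isRAS123-accepting : ∀ {m p s v} → InState m p s v → isRAS123 p ≡ accepting s v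
isRAS123-accepting {p = p} {freshMin e} I with lastLetter I
... | _ , new , a , u , init≡a∷u =
  isRAS123-ascbot p (trans (cong ascbotEqNub (trans (p≡init∷ʳlast I) (cong (_∷ʳ last I) init≡a∷u)))
                           (trans (ascbotEqNub-++ a u (last I) [])
                                  (∧-falseʳ _ (subst (λ q → elemᵇ (last I) q ≡ false) init≡a∷u new))))
isRAS123-accepting {p = p} {repeatMin e}   {1}           I = isRAS123-repeat I (proj₂ (lastLetter I))
isRAS123-accepting {p = p} {repeatAbove d} {1}           I = isRAS123-repeat I (inj₂ (proj₂ (lastLetter I)))
isRAS123-accepting {p = p} {repeatMin e}   {suc (suc v)} I = isRAS123-cayley p (isCayley-min≥2 I (s≤s (s≤s z≤n)))
isRAS123-accepting {p = p} {repeatAbove d} {suc (suc v)} I = isRAS123-cayley p (isCayley-min≥2 I (s≤s (s≤s z≤n)))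
isRAS123-accepting {s = repeatMin e}   {zero} I = ⊥-elim (1+n≰n (1≤v I))
isRAS123-accepting {s = repeatAbove d} {zero} I = ⊥-elim (1+n≰n (1≤v I))

-- Counting words by walks

count-words-suc : ∀ (f : List ℕ → Bool) L k →
  count f (words L (suc k)) ≡ sumUpTo L (λ x → count (λ w → f (x ∷ w)) (words L k))
count-words-suc f L k = trans (by-letter (range1 L)) (sum-range1 _ L)
  where
  by-letter : ∀ xs → count f (concatMap (λ x → map (x ∷_) (words L k)) xs)
                     ≡ sum (map (λ x → count (λ w → f (x ∷ w)) (words L k)) xs)
  by-letter []       = refl
  by-letter (x ∷ xs) = trans (count-++ f (map (x ∷_) (words L k)) _)
                             (cong₂ _+_ (count-map f (x ∷_) (words L k)) (by-letter xs))

continuations : ℕ → List ℕ → ℕ → ℕ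
continuations L p k = count (λ w → isRAS123 (p ++ w)) (words L k)

continuations-suc : ∀ L p k → continuations L p (suc k) ≡ sumUpTo L (λ x → continuations L (p ∷ʳ x) k)
continuations-suc L p k = trans (count-words-suc (λ w → isRAS123 (p ++ w)) L k)
  (sumUpTo-cong L (λ x _ _ → count-cong (words L k) (λ w → cong isRAS123 (sym (++-assoc p (x ∷ []) w)))))

aboveStates : ℕ → List State
aboveStates h = map repeatAbove (range1 h)

successors : State → List State
successors (repeatMin e)   = freshMin e ∷ repeatMin e ∷ []
successors (freshMin e)    = aboveStates (suc e)
successors (repeatAbove d) = freshMin d ∷ repeatMin d ∷ aboveStates d

collect : (State → ℕ → ℕ) → Maybe (State × ℕ) → ℕ
collect f nothing        = 0
collect f (just (s , v)) = f s v

-- Entering freshMin lowers the minimum by one, which must stay positive.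
entering : (State → ℕ → ℕ) → State → ℕ → ℕ
entering f (freshMin e) (suc (suc v)) = f (freshMin e) (suc v)
entering f (freshMin e) _             = 0
entering f t            v             = f t v

transition-farBelow : ∀ s {v x} → 2 + x ≤ v → transition s v x ≡ nothing
transition-farBelow (repeatMin _)   {v} {x} x+2≤v rewrite offset-farBelow x v x+2≤v = refl
transition-farBelow (freshMin _)    {v} {x} x+2≤v rewrite offset-farBelow x v x+2≤v = refl
transition-farBelow (repeatAbove _) {v} {x} x+2≤v rewrite offset-farBelow x v x+2≤v = refl

transition-freshMin-low : ∀ e {v x} → x ≤ v → transition (freshMin e) v x ≡ nothing
transition-freshMin-low e {v} {x} x≤v with offset x v | offset-spec x v
... | farBelow  | _           = refl
... | justBelow | _           = refl
... | equal     | _           = refl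
... | over i    | over .i refl = ⊥-elim (m+1+n≰m v x≤v)

transition-repeatMin-high : ∀ e {v x} → v < x → transition (repeatMin e) v x ≡ nothing
transition-repeatMin-high e {v} {x} v<x with offset x v | offset-spec x v
... | farBelow  | _              = refl
... | justBelow | justBelow refl = ⊥-elim (<-asym v<x (n<1+n x))
... | equal     | equal refl     = ⊥-elim (<-irrefl refl v<x)
... | over i    | _              = refl

transition-aboveCap : ∀ s {v x} → cap s v < x → transition s v x ≡ nothing
transition-aboveCap (repeatMin e) {v} cap<x = transition-repeatMin-high e (≤-<-trans (m≤m+n v e) cap<x)
transition-aboveCap (freshMin e) {v} {x} cap<x with offset x v | offset-spec x v
... | farBelow  | _            = refl
... | justBelow | _            = refl
... | equal     | _            = refl
... | over i    | over .i refl rewrite ≥⇒<ᵇ≡false (s≤s⁻¹ (+-cancelˡ-< v (suc e) (suc i) cap<x)) = refl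
transition-aboveCap (repeatAbove d) {v} {x} cap<x with offset x v | offset-spec x v
... | farBelow  | _              = refl
... | justBelow | justBelow refl = ⊥-elim (<-asym (≤-<-trans (m≤m+n _ d) cap<x) (n<1+n x))
... | equal     | equal refl     = ⊥-elim (<-irrefl refl (≤-<-trans (m≤m+n _ d) cap<x))
... | over i    | over .i refl rewrite ≥⇒<ᵇ≡false (s≤s⁻¹ (+-cancelˡ-< v d (suc i) cap<x)) = refl

sumUpTo-letters-belowMin : ∀ f s v → 1 ≤ v →
  (∀ x → move s (suc x) x justBelow ≡ just (freshMin (headroom s) , x)) →
  move s v v equal ≡ just (repeatMin (headroom s) , v) →
  sumUpTo v (λ x → collect f (transition s v x)) ≡ entering f (freshMin (headroom s)) v + f (repeatMin (headroom s)) v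
sumUpTo-letters-belowMin f s (suc zero) _ _ equal-step rewrite equal-step = refl
sumUpTo-letters-belowMin f s (suc (suc v)) _ below-step equal-step
  rewrite sumUpTo-zero v {λ x → collect f (transition s (suc (suc v)) x)}
            (λ x _ x≤v → cong (collect f) (transition-farBelow s (s≤s (s≤s x≤v))))
        | offset-justBelow v | below-step (suc v) | offset-equal v | equal-step = refl

sumUpTo-letters-aboveMin : ∀ f s v h →
  (∀ i → i < h → move s v (v + suc i) (over i) ≡ just (repeatAbove (suc i) , v)) →
  sumUpTo h (λ i → collect f (transition s v (v + i))) ≡ sumUpTo h (λ i → f (repeatAbove i) v)
sumUpTo-letters-aboveMin f s v h over-step = sumUpTo-cong h letter
  where
  letter : ∀ i → 1 ≤ i → i ≤ h → collect f (transition s v (v + i)) ≡ f (repeatAbove i) v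
  letter (suc i) _ i<h rewrite offset-over v i | over-step i i<h = refl

sum-aboveStates : ∀ (f : State → ℕ) h → sum (map f (aboveStates h)) ≡ sumUpTo h (f ∘ repeatAbove)
sum-aboveStates f h = trans (cong sum (sym (map-∘ (range1 h)))) (sum-range1 (f ∘ repeatAbove) h)

sumUpTo-letters-cap : ∀ f s v → 1 ≤ v →
  sumUpTo (cap s v) (λ x → collect f (transition s v x)) ≡ sum (map (λ t → entering f t v) (successors s))
sumUpTo-letters-cap f (repeatMin e) v 1≤v = begin
  sumUpTo (v + e) g
    ≡⟨ sumUpTo-tail (m≤m+n v e) (λ x v<x → cong (collect f) (transition-repeatMin-high e v<x)) ⟩
  sumUpTo v g
    ≡⟨ sumUpTo-letters-belowMin f (repeatMin e) v 1≤v (λ _ → refl) refl ⟩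
  entering f (freshMin e) v + f (repeatMin e) v
    ≡⟨ cong (entering f (freshMin e) v +_) (+-identityʳ (f (repeatMin e) v)) ⟨
  entering f (freshMin e) v + (f (repeatMin e) v + 0) ∎
  where
  open ≡-Reasoning
  g = λ x → collect f (transition (repeatMin e) v x)
sumUpTo-letters-cap f (freshMin e) v 1≤v = begin
  sumUpTo (v + suc e) g
    ≡⟨ sumUpTo-+ v (suc e) g ⟩
  sumUpTo v g + sumUpTo (suc e) (λ i → g (v + i))
    ≡⟨ cong₂ _+_ (sumUpTo-zero v (λ x _ x≤v → cong (collect f) (transition-freshMin-low e x≤v)))
                 (sumUpTo-letters-aboveMin f (freshMin e) v (suc e) (λ i i<h → if-true _ nothing (<⇒<ᵇ≡true i<h))) ⟩
  sumUpTo (suc e) (λ i → f (repeatAbove i) v)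
    ≡⟨ sum-aboveStates (λ t → entering f t v) (suc e) ⟨
  sum (map (λ t → entering f t v) (aboveStates (suc e))) ∎
  where
  open ≡-Reasoning
  g = λ x → collect f (transition (freshMin e) v x)
sumUpTo-letters-cap f (repeatAbove d) v 1≤v = begin
  sumUpTo (v + d) g
    ≡⟨ sumUpTo-+ v d g ⟩
  sumUpTo v g + sumUpTo d (λ i → g (v + i))
    ≡⟨ cong₂ _+_ (sumUpTo-letters-belowMin f (repeatAbove d) v 1≤v (λ _ → refl) refl)
                 (sumUpTo-letters-aboveMin f (repeatAbove d) v d (λ i i<d → if-true _ nothing (<⇒<ᵇ≡true i<d))) ⟩
  (entering f (freshMin d) v + f (repeatMin d) v) + sumUpTo d (λ i → f (repeatAbove i) v)
    ≡⟨ +-assoc (entering f (freshMin d) v) _ _ ⟩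
  entering f (freshMin d) v + (f (repeatMin d) v + sumUpTo d (λ i → f (repeatAbove i) v))
    ≡⟨ cong (λ n → entering f (freshMin d) v + (f (repeatMin d) v + n)) (sum-aboveStates (λ t → entering f t v) d) ⟨
  entering f (freshMin d) v + (f (repeatMin d) v + sum (map (λ t → entering f t v) (aboveStates d))) ∎
  where
  open ≡-Reasoning
  g = λ x → collect f (transition (repeatAbove d) v x)

sumUpTo-letters : ∀ f s v L → 1 ≤ v → cap s v ≤ L →
  sumUpTo L (λ x → collect f (transition s v x)) ≡ sum (map (λ t → entering f t v) (successors s))
sumUpTo-letters f s v L 1≤v cap≤L =
  trans (sumUpTo-tail cap≤L (λ x cap<x → cong (collect f) (transition-aboveCap s cap<x)))
        (sumUpTo-letters-cap f s v 1≤v)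

boundedWalks : State → ℕ → ℕ → ℕ
boundedWalks s v zero    = boolToℕ (accepting s v)
boundedWalks s v (suc k) = sum (map (λ t → entering (λ s′ v′ → boundedWalks s′ v′ k) t v) (successors s))

continuations≡boundedWalks : ∀ {m p s v} L k → InState m p s v → m ≤ L →
  continuations L p k ≡ boundedWalks s v k
continuations≡boundedWalks {p = p} L zero I m≤L =
  trans (count-single (λ w → isRAS123 (p ++ w)) [])
        (cong boolToℕ (trans (cong isRAS123 (++-identityʳ p)) (isRAS123-accepting I)))
continuations≡boundedWalks {p = p} {s} {v} L (suc k) I m≤L = begin
  continuations L p (suc k)
    ≡⟨ continuations-suc L p k ⟩
  sumUpTo L (λ x → continuations L (p ∷ʳ x) k)
    ≡⟨ sumUpTo-cong L letter ⟩
  sumUpTo L (λ x → collect (λ s′ v′ → boundedWalks s′ v′ k) (transition s v x))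
    ≡⟨ sumUpTo-letters _ s v L (1≤v I) (≤-trans (cap≤m I) m≤L) ⟩
  boundedWalks s v (suc k) ∎
  where
  open ≡-Reasoning
  letter : ∀ x → 1 ≤ x → x ≤ L →
    continuations L (p ∷ʳ x) k ≡ collect (λ s′ v′ → boundedWalks s′ v′ k) (transition s v x)
  letter x 1≤x _ with transition s v x in t
  ... | nothing        = count-none _ (words L k)
                           (λ w → trans (cong isRAS123 (++-assoc p (x ∷ []) w)) (dies I 1≤x t w))
  ... | just (s′ , v′) = continuations≡boundedWalks L k (step I 1≤x t) m≤L

length-hatB-byFirstLetter : ∀ n → length (hatB (suc n) σ123) ≡ sumUpTo (suc n) (λ m → boundedWalks (repeatMin 0) m n)
length-hatB-byFirstLetter n = trans (count-words-suc isRAS123 (suc n) n)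
  (sumUpTo-cong (suc n) (λ m 1≤m m≤L → continuations≡boundedWalks (suc n) n (inState-first m 1≤m) m≤L))

walks : (State → ℕ) → State → ℕ → ℕ
walks a s zero    = a s
walks a s (suc k) = sum (map (λ t → walks a t k) (successors s))

final : State → ℕ
final (freshMin _) = 0
final _            = 1

b : ℕ → ℕ
b = walks final (repeatMin 0)

-- A walk with j steps into freshMin is counted exactly once, from the starting minimum v = j + 1 ≤ k + 1 ≤ K.
sumUpTo-boundedWalks : ∀ k s K → k < K → sumUpTo K (λ v → boundedWalks s v k) ≡ walks final s k
sumUpTo-boundedWalks zero s (suc K) _ =
  trans (sumUpTo-suc-shift K (λ v → boundedWalks s v 0))
        (trans (cong₂ _+_ (accepts-at-1 s) (sumUpTo-zero K (λ v 1≤v _ → rejects-above-1 s 1≤v)))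
               (+-identityʳ (final s)))
  where
  accepts-at-1 : ∀ s → boolToℕ (accepting s 1) ≡ final s
  accepts-at-1 (repeatMin _)   = refl
  accepts-at-1 (freshMin _)    = refl
  accepts-at-1 (repeatAbove _) = refl
  rejects-above-1 : ∀ s {v} → 1 ≤ v → boolToℕ (accepting s (suc v)) ≡ 0
  rejects-above-1 (repeatMin _)   (s≤s _) = refl
  rejects-above-1 (freshMin _)    (s≤s _) = refl
  rejects-above-1 (repeatAbove _) (s≤s _) = refl
sumUpTo-boundedWalks (suc k) s (suc K) (s≤s k<K) =
  trans (sumUpTo-sum (suc K) (λ t v → entering (λ s′ v′ → boundedWalks s′ v′ k) t v) (successors s))
        (cong sum (map-cong per (successors s)))
  where
  per : ∀ t → sumUpTo (suc K) (entering (λ s′ v′ → boundedWalks s′ v′ k) t) ≡ walks final t k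
  per (repeatMin e)   = sumUpTo-boundedWalks k (repeatMin e) (suc K) (m<n⇒m<1+n k<K)
  per (repeatAbove d) = sumUpTo-boundedWalks k (repeatAbove d) (suc K) (m<n⇒m<1+n k<K)
  per (freshMin e)    = trans (sumUpTo-suc-shift K _)
                              (trans (sumUpTo-cong K (λ { (suc v) _ _ → refl }))
                                     (sumUpTo-boundedWalks k (freshMin e) K k<K))

length-hatB≡b : ∀ n → length (hatB (suc n) σ123) ≡ b n
length-hatB≡b n = trans (length-hatB-byFirstLetter n) (sumUpTo-boundedWalks n (repeatMin 0) (suc n) ≤-refl)

-- Recurrences

endsMin endsFresh endsAbove endsNotMin : State → ℕ
endsMin (repeatMin _) = 1
endsMin _             = 0
endsFresh (freshMin _) = 1
endsFresh _            = 0
endsAbove (repeatAbove _) = 1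
endsAbove _               = 0
endsNotMin (repeatMin _) = 0
endsNotMin _             = 1

walks-cong : ∀ {a b} → (∀ t → a t ≡ b t) → ∀ s k → walks a s k ≡ walks b s k
walks-cong a≗b s zero    = a≗b s
walks-cong a≗b s (suc k) = cong sum (map-cong (λ t → walks-cong a≗b t k) (successors s))

walks-+ : ∀ a b s k → walks (λ t → a t + b t) s k ≡ walks a s k + walks b s k
walks-+ a b s zero    = refl
walks-+ a b s (suc k) = trans (cong sum (map-cong (λ t → walks-+ a b t k) (successors s)))
                              (sum-map-+ (λ t → walks a t k) (λ t → walks b t k) (successors s))

-- Every successor list contains freshMin h exactly when it contains repeatMin h.
walks-endsFresh : ∀ s k → walks endsFresh s (suc k) ≡ walks endsMin s (suc k)
walks-endsFresh (repeatMin e)   zero = refl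
walks-endsFresh (freshMin e)    zero = trans (sum-aboveStates endsFresh (suc e)) (sym (sum-aboveStates endsMin (suc e)))
walks-endsFresh (repeatAbove d) zero = cong suc (trans (sum-aboveStates endsFresh d) (sym (sum-aboveStates endsMin d)))
walks-endsFresh s (suc k) = cong sum (map-cong (λ t → walks-endsFresh t k) (successors s))

walks-endsNotMin : ∀ s k → walks endsNotMin s (suc k) ≡ walks final s (suc k)
walks-endsNotMin s k = begin
  walks endsNotMin s (suc k)                             ≡⟨ walks-cong notMin-split s (suc k) ⟩
  walks (λ t → endsAbove t + endsFresh t) s (suc k)      ≡⟨ walks-+ endsAbove endsFresh s (suc k) ⟩
  walks endsAbove s (suc k) + walks endsFresh s (suc k)  ≡⟨ cong (walks endsAbove s (suc k) +_) (walks-endsFresh s k) ⟩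
  walks endsAbove s (suc k) + walks endsMin s (suc k)    ≡⟨ +-comm (walks endsAbove s (suc k)) _ ⟩
  walks endsMin s (suc k) + walks endsAbove s (suc k)    ≡⟨ walks-+ endsMin endsAbove s (suc k) ⟨
  walks (λ t → endsMin t + endsAbove t) s (suc k)        ≡⟨ walks-cong final-split s (suc k) ⟨
  walks final s (suc k)                                  ∎
  where
  open ≡-Reasoning
  notMin-split : ∀ t → endsNotMin t ≡ endsAbove t + endsFresh t
  notMin-split (repeatMin _)   = refl
  notMin-split (freshMin _)    = refl
  notMin-split (repeatAbove _) = refl
  final-split : ∀ t → final t ≡ endsMin t + endsAbove t
  final-split (repeatMin _)   = refl
  final-split (freshMin _)    = refl
  final-split (repeatAbove _) = refl

raise : State → State
raise (repeatMin e)   = repeatMin (suc e)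
raise (freshMin e)    = freshMin (suc e)
raise (repeatAbove d) = repeatAbove (suc d)

aboveStates-suc : ∀ h → aboveStates (suc h) ≡ repeatAbove 1 ∷ map raise (aboveStates h)
aboveStates-suc h = trans (cong (map repeatAbove) (range1-suc h))
                          (cong (repeatAbove 1 ∷_) (trans (sym (map-∘ (range1 h))) (map-∘ (range1 h))))

sum-aboveStates-suc : ∀ (f : State → ℕ) h →
  sum (map f (aboveStates (suc h))) ≡ f (repeatAbove 1) + sum (map (f ∘ raise) (aboveStates h))
sum-aboveStates-suc f h = trans (cong (sum ∘ map f) (aboveStates-suc h))
                                (cong (λ xs → f (repeatAbove 1) + sum xs) (sym (map-∘ (aboveStates h))))

sum-successors-raise : ∀ (f : State → ℕ) s →
  sum (map f (successors (raise s))) ≡ sum (map (f ∘ raise) (successors s)) + endsNotMin s * f (repeatAbove 1)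
sum-successors-raise f (repeatMin e)   = sym (+-identityʳ _)
sum-successors-raise f (freshMin e)    =
  trans (sum-aboveStates-suc f (suc e)) (swap (f (repeatAbove 1)) (sum (map (f ∘ raise) (aboveStates (suc e)))))
  where
  swap : ∀ c x → c + x ≡ x + (c + 0)
  swap = solve-∀
sum-successors-raise f (repeatAbove d) =
  trans (cong (λ n → f (freshMin (suc d)) + (f (repeatMin (suc d)) + n)) (sum-aboveStates-suc f d))
        (shuffle (f (freshMin (suc d))) (f (repeatMin (suc d))) (f (repeatAbove 1)) (sum (map (f ∘ raise) (aboveStates d))))
  where
  shuffle : ∀ a b c x → a + (b + (c + x)) ≡ a + (b + x) + (c + 0)
  shuffle = solve-∀

q : ℕ → ℕ
q = walks final (repeatAbove 1)

walks-raise : ∀ n s → walks final (raise s) (suc n) ≡ walks final s (suc n) + conv (walks endsNotMin s) q n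
walks-raise zero s =
  trans (sum-successors-raise final s) (cong (_+ endsNotMin s * 1) (cong sum (map-cong final-raise (successors s))))
  where
  final-raise : ∀ t → final (raise t) ≡ final t
  final-raise (repeatMin _)   = refl
  final-raise (freshMin _)    = refl
  final-raise (repeatAbove _) = refl
walks-raise (suc m) s = begin
  walks final (raise s) (suc (suc m))
    ≡⟨ sum-successors-raise (λ t → walks final t (suc m)) s ⟩
  sum (map (λ t → walks final (raise t) (suc m)) (successors s)) + endsNotMin s * q (suc m)
    ≡⟨ cong (_+ endsNotMin s * q (suc m)) (cong sum (map-cong (λ t → walks-raise m t) (successors s))) ⟩
  sum (map (λ t → walks final t (suc m) + conv (walks endsNotMin t) q m) (successors s)) + endsNotMin s * q (suc m)
    ≡⟨ cong (_+ endsNotMin s * q (suc m))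
            (trans (sum-map-+ (λ t → walks final t (suc m)) (λ t → conv (walks endsNotMin t) q m) (successors s))
                   (cong (walks final s (suc (suc m)) +_) (sum-conv (walks endsNotMin) q (successors s) m))) ⟩
  walks final s (suc (suc m)) + conv (walks endsNotMin s ∘ suc) q m + endsNotMin s * q (suc m)
    ≡⟨ rotate (walks final s (suc (suc m))) (conv (walks endsNotMin s ∘ suc) q m) (endsNotMin s * q (suc m)) ⟩
  walks final s (suc (suc m)) + conv (walks endsNotMin s) q (suc m) ∎
  where
  open ≡-Reasoning
  rotate : ∀ a b c → a + b + c ≡ a + (c + b)
  rotate = solve-∀

walks-above2 : ∀ n → walks final (repeatAbove 2) (suc n) ≡ q (suc n) + conv q q n
walks-above2 n = trans (walks-raise n (repeatAbove 1)) (cong (q (suc n) +_) (conv-congˡ q n notMin≡q))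
  where
  notMin≡q : ∀ i → walks endsNotMin (repeatAbove 1) i ≡ q i
  notMin≡q zero    = refl
  notMin≡q (suc i) = walks-endsNotMin (repeatAbove 1) i

-- Unfold two steps from repeatAbove 1, whose successors are freshMin 1, repeatMin 1 and repeatAbove 1.
q-suc-suc : ∀ n → q (suc (suc n)) ≡ walks final (repeatAbove 2) n + (q (suc n) + q (suc n))
q-suc-suc n = unfolded (walks final (freshMin 1) n) (walks final (repeatMin 1) n) (q n) (walks final (repeatAbove 2) n)
  where
  unfolded : ∀ a b c d → (c + (d + 0)) + ((a + (b + 0)) + ((a + (b + (c + 0))) + 0))
                         ≡ d + ((a + (b + (c + 0))) + (a + (b + (c + 0))))
  unfolded = solve-∀

q-recurrence : ∀ m → q (3 + m) ≡ q (2 + m) + q (2 + m) + q (1 + m) + conv q q m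
q-recurrence m rewrite q-suc-suc (suc m) | walks-above2 m = rearrange (q (suc m)) (conv q q m) (q (suc (suc m)))
  where
  rearrange : ∀ a c b → (a + c) + (b + b) ≡ b + b + a + c
  rearrange = solve-∀

b-suc-suc : ∀ n → b (2 + n) ≡ q n + b (1 + n)
b-suc-suc n = unfolded (q n) (b (suc n))
  where
  unfolded : ∀ x y → (x + 0) + (y + 0) ≡ x + y
  unfolded = solve-∀

-- The generating function

open import Data.Integer using (ℤ; +_; -[1+_]; -_) renaming (_+_ to _+ℤ_; _*_ to _*ℤ_; _-_ to _-ℤ_)
import Data.Integer.Properties as ℤ
open import Data.Integer.Tactic.RingSolver using () renaming (solve-∀ to solveℤ-∀)

cauchy : PS → PS → PS
cauchy f g zero    = f 0 *ℤ g 0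
cauchy f g (suc n) = f 0 *ℤ g (suc n) +ℤ cauchy (f ∘ suc) g n

⊛≗cauchy : ∀ f g n → (f ⊛ g) n ≡ cauchy f g n
⊛≗cauchy f g zero    = ℤ.+-identityʳ (f 0 *ℤ g 0)
⊛≗cauchy f g (suc n) = cong (f 0 *ℤ g (suc n) +ℤ_) (begin
  sumℤ (map (λ k → f k *ℤ g (suc n ∸ k)) (applyUpTo suc (suc n)))
    ≡⟨ cong sumℤ (map-applyUpTo suc (λ k → f k *ℤ g (suc n ∸ k)) (suc n)) ⟩
  sumℤ (applyUpTo (λ k → f (suc k) *ℤ g (n ∸ k)) (suc n))
    ≡⟨ cong sumℤ (map-upTo (λ k → f (suc k) *ℤ g (n ∸ k)) (suc n)) ⟨
  ((f ∘ suc) ⊛ g) n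
    ≡⟨ ⊛≗cauchy (f ∘ suc) g n ⟩
  cauchy (f ∘ suc) g n ∎)
  where open ≡-Reasoning

cauchy-comm : ∀ n f g → cauchy f g n ≡ cauchy g f n
cauchy-comm zero          f g = ℤ.*-comm (f 0) (g 0)
cauchy-comm (suc zero)    f g = swap (f 0) (f 1) (g 0) (g 1)
  where
  swap : ∀ a b c d → a *ℤ d +ℤ b *ℤ c ≡ c *ℤ b +ℤ d *ℤ a
  swap = solveℤ-∀
cauchy-comm (suc (suc n)) f g = begin
  f 0 *ℤ g (2 + n) +ℤ cauchy (f ∘ suc) g (suc n)
    ≡⟨ cong (f 0 *ℤ g (2 + n) +ℤ_) (cauchy-comm (suc n) (f ∘ suc) g) ⟩
  f 0 *ℤ g (2 + n) +ℤ (g 0 *ℤ f (2 + n) +ℤ cauchy (g ∘ suc) (f ∘ suc) n)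
    ≡⟨ cong (λ z → f 0 *ℤ g (2 + n) +ℤ (g 0 *ℤ f (2 + n) +ℤ z)) (cauchy-comm n (g ∘ suc) (f ∘ suc)) ⟩
  f 0 *ℤ g (2 + n) +ℤ (g 0 *ℤ f (2 + n) +ℤ cauchy (f ∘ suc) (g ∘ suc) n)
    ≡⟨ swap (f 0 *ℤ g (2 + n)) (g 0 *ℤ f (2 + n)) (cauchy (f ∘ suc) (g ∘ suc) n) ⟩
  g 0 *ℤ f (2 + n) +ℤ (f 0 *ℤ g (2 + n) +ℤ cauchy (f ∘ suc) (g ∘ suc) n)
    ≡⟨ cong (g 0 *ℤ f (2 + n) +ℤ_) (cauchy-comm (suc n) (g ∘ suc) f) ⟨
  g 0 *ℤ f (2 + n) +ℤ cauchy (g ∘ suc) f (suc n) ∎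
  where
  open ≡-Reasoning
  swap : ∀ a b x → a +ℤ (b +ℤ x) ≡ b +ℤ (a +ℤ x)
  swap = solveℤ-∀

cauchy-cong : ∀ n {f f′ g g′} → (∀ i → f i ≡ f′ i) → (∀ i → g i ≡ g′ i) →
  cauchy f g n ≡ cauchy f′ g′ n
cauchy-cong zero    ef eg = cong₂ _*ℤ_ (ef 0) (eg 0)
cauchy-cong (suc n) ef eg = cong₂ _+ℤ_ (cong₂ _*ℤ_ (ef 0) (eg (suc n))) (cauchy-cong n (ef ∘ suc) eg)

cauchy-zeroˡ : ∀ n g → cauchy (λ _ → + 0) g n ≡ + 0
cauchy-zeroˡ zero    g = refl
cauchy-zeroˡ (suc n) g = cong (+ 0 +ℤ_) (cauchy-zeroˡ n g)

cauchy-scaleˡ : ∀ n c f g → cauchy (λ i → c *ℤ f i) g n ≡ c *ℤ cauchy f g n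
cauchy-scaleˡ zero    c f g = ℤ.*-assoc c (f 0) (g 0)
cauchy-scaleˡ (suc n) c f g rewrite cauchy-scaleˡ n c (f ∘ suc) g =
  distrib c (f 0) (g (suc n)) (cauchy (f ∘ suc) g n)
  where
  distrib : ∀ c a b x → c *ℤ a *ℤ b +ℤ c *ℤ x ≡ c *ℤ (a *ℤ b +ℤ x)
  distrib = solveℤ-∀

cauchy-+ : ∀ n (a b : ℕ → ℕ) → cauchy (λ i → + a i) (λ i → + b i) n ≡ + conv a b n
cauchy-+ zero    a b = sym (ℤ.pos-* (a 0) (b 0))
cauchy-+ (suc n) a b rewrite cauchy-+ n (a ∘ suc) b =
  sym (trans (ℤ.pos-+ (a 0 * b (suc n)) (conv (a ∘ suc) b n))
             (cong (_+ℤ + conv (a ∘ suc) b n) (ℤ.pos-* (a 0) (b (suc n)))))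

cauchy-linear : ∀ n x y g → cauchy (poly (x ∷ y ∷ [])) g (suc n) ≡ x *ℤ g (suc n) +ℤ y *ℤ g n
cauchy-linear zero    x y g = refl
cauchy-linear (suc n) x y g rewrite cauchy-zeroˡ n g = cong (x *ℤ g (2 + n) +ℤ_) (ℤ.+-identityʳ (y *ℤ g (suc n)))

F123-suc : ∀ n → F123 (suc n) ≡ + b n
F123-suc n = cong +_ (length-hatB≡b n)

Q : PS
Q i = + q i

Q-recurrence : ∀ m → Q (3 + m) ≡ Q (2 + m) +ℤ Q (2 + m) +ℤ Q (1 + m) +ℤ + conv q q m
Q-recurrence m = trans (cong +_ (q-recurrence m))
  (trans (ℤ.pos-+ (q (2 + m) + q (2 + m) + q (1 + m)) (conv q q m))
         (cong (_+ℤ + conv q q m) (trans (ℤ.pos-+ (q (2 + m) + q (2 + m)) (q (1 + m)))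
                                         (cong (_+ℤ Q (1 + m)) (ℤ.pos-+ (q (2 + m)) (q (2 + m)))))))

root : PS
root 0                   = + 1
root 1                   = -[1+ 1 ]
root 2                   = -[1+ 0 ]
root (suc (suc (suc n))) = -[1+ 1 ] *ℤ Q n

root-closed : ∀ n → ((poly (-[1+ 1 ] ∷ + 2 ∷ []) ⊛ F123) ⊖ poly (-[1+ 0 ] ∷ + 0 ∷ + 1 ∷ [])) n ≡ root n
root-closed n = trans (cong (_-ℤ poly (-[1+ 0 ] ∷ + 0 ∷ + 1 ∷ []) n) (⊛≗cauchy _ F123 n)) (closed n)
  where
  closed : ∀ n → cauchy (poly (-[1+ 1 ] ∷ + 2 ∷ [])) F123 n -ℤ poly (-[1+ 0 ] ∷ + 0 ∷ + 1 ∷ []) n ≡ root n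
  closed 0 = refl
  closed 1 = refl
  closed 2 = refl
  closed (suc (suc (suc k))) = begin
    cauchy (poly (-[1+ 1 ] ∷ + 2 ∷ [])) F123 (3 + k) -ℤ + 0
      ≡⟨ cong (_-ℤ + 0) (cauchy-linear (2 + k) -[1+ 1 ] (+ 2) F123) ⟩
    -[1+ 1 ] *ℤ F123 (3 + k) +ℤ + 2 *ℤ F123 (2 + k) -ℤ + 0
      ≡⟨ cong₂ (λ x y → -[1+ 1 ] *ℤ x +ℤ + 2 *ℤ y -ℤ + 0)
               (trans (F123-suc (2 + k)) (trans (cong +_ (b-suc-suc k)) (ℤ.pos-+ (q k) (b (1 + k)))))
               (F123-suc (1 + k)) ⟩
    -[1+ 1 ] *ℤ (Q k +ℤ + b (1 + k)) +ℤ + 2 *ℤ + b (1 + k) -ℤ + 0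
      ≡⟨ telescope (Q k) (+ b (1 + k)) ⟩
    -[1+ 1 ] *ℤ Q k ∎
    where
    open ≡-Reasoning
    telescope : ∀ x y → -[1+ 1 ] *ℤ (x +ℤ y) +ℤ + 2 *ℤ y -ℤ + 0 ≡ -[1+ 1 ] *ℤ x
    telescope = solveℤ-∀

cauchy-root : ∀ g n → cauchy root g (3 + n)
  ≡ + 1 *ℤ g (3 + n) +ℤ (-[1+ 1 ] *ℤ g (2 + n) +ℤ (-[1+ 0 ] *ℤ g (1 + n) +ℤ -[1+ 1 ] *ℤ cauchy Q g n))
cauchy-root g n = cong (λ z → + 1 *ℤ g (3 + n) +ℤ (-[1+ 1 ] *ℤ g (2 + n) +ℤ (-[1+ 0 ] *ℤ g (1 + n) +ℤ z)))
                       (cauchy-scaleˡ n -[1+ 1 ] Q g)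

cauchy-root-Q : ∀ m → cauchy root Q (3 + m) ≡ - (+ conv q q m)
cauchy-root-Q m =
  trans (cauchy-root Q m)
        (trans (cong₂ (λ x z → + 1 *ℤ x +ℤ (-[1+ 1 ] *ℤ Q (2 + m) +ℤ (-[1+ 0 ] *ℤ Q (1 + m) +ℤ -[1+ 1 ] *ℤ z)))
                      (Q-recurrence m) (cauchy-+ m q q))
               (cancel (Q (2 + m)) (Q (1 + m)) (+ conv q q m)))
  where
  cancel : ∀ a b c →
    + 1 *ℤ (a +ℤ a +ℤ b +ℤ c) +ℤ (-[1+ 1 ] *ℤ a +ℤ (-[1+ 0 ] *ℤ b +ℤ -[1+ 1 ] *ℤ c)) ≡ - c
  cancel = solveℤ-∀

root² : ∀ n → cauchy root root n ≡ poly (+ 1 ∷ -[1+ 3 ] ∷ + 2 ∷ + 0 ∷ + 1 ∷ []) n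
root² 0 = refl
root² 1 = refl
root² 2 = refl
root² 3 = refl
root² 4 = refl
root² 5 = refl
root² (suc (suc (suc (suc (suc (suc m)))))) =
  trans (cauchy-root root (3 + m))
        (trans (cong₂ (λ x z → + 1 *ℤ (-[1+ 1 ] *ℤ x)
                               +ℤ (-[1+ 1 ] *ℤ root (5 + m) +ℤ (-[1+ 0 ] *ℤ root (4 + m) +ℤ -[1+ 1 ] *ℤ z)))
                      (Q-recurrence m) (trans (cauchy-comm (3 + m) Q root) (cauchy-root-Q m)))
               (cancel (Q (2 + m)) (Q (1 + m)) (+ conv q q m)))
  where
  cancel : ∀ a b c → + 1 *ℤ (-[1+ 1 ] *ℤ (a +ℤ a +ℤ b +ℤ c))
                     +ℤ (-[1+ 1 ] *ℤ (-[1+ 1 ] *ℤ a) +ℤ (-[1+ 0 ] *ℤ (-[1+ 1 ] *ℤ b) +ℤ -[1+ 1 ] *ℤ (- c)))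
                     ≡ + 0
  cancel = solveℤ-∀

mainTheorem13 :
    (∀ n → (((poly (-[1+ 1 ] ∷ + 2 ∷ []) ⊛ F123) ⊖ poly (-[1+ 0 ] ∷ + 0 ∷ + 1 ∷ []))
             ⊛ ((poly (-[1+ 1 ] ∷ + 2 ∷ []) ⊛ F123) ⊖ poly (-[1+ 0 ] ∷ + 0 ∷ + 1 ∷ []))) n
           ≡ poly (+ 1 ∷ -[1+ 3 ] ∷ + 2 ∷ + 0 ∷ + 1 ∷ []) n)
    × (((poly (-[1+ 1 ] ∷ + 2 ∷ []) ⊛ F123) ⊖ poly (-[1+ 0 ] ∷ + 0 ∷ + 1 ∷ [])) 0 ≡ + 1)
mainTheorem13 =
  (λ n → trans (⊛≗cauchy _ _ n) (trans (cauchy-cong n root-closed root-closed) (root² n))) ,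
  root-closed 0
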